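{- Let $q$ be an odd prime power and $m\ge2$ an integer with $m\mid q+1$. For the subgraph of $\mathrm{GP}(q^2,m)$ induced by $Q$ the following hold. (1) Assume $m\mid\frac{q+1}{2}$. Then for any $0\le i_1<i_2\le m-1$, all possible edges are present between $Q_{i_1}$ and $Q_{i_2}$ if $i_1+i_2\equiv0\pmod m$, and there are no edges between them otherwise. (1.1) If moreover $m$ is odd, then $Q_0$ is a clique and $Q_1,\dots,Q_{m-1}$ are independent sets; in particular $Q_1\cup Q_{m-1},\dots,Q_{\frac{m-1}{2}}\cup Q_{\frac{m+1}{2}}$ induce $\frac{m-1}{2}$ complete bipartite graphs. (1.2) If moreover $m$ is even, then $Q_0$ and $Q_{m/2}$ are cliques and $Q_1,\dots,Q_{\frac m2-1},Q_{\frac m2+1},\dots,Q_{m-1}$ are independent sets; in particular, if $m\ge4$, then $Q_1\cup Q_{m-1},\dots,Q_{\frac m2-1}\cup Q_{\frac m2+1}$ induce $\frac m2-1$ complete bipartite graphs. (2) Assume $m\nmid\frac{q+1}{2}$. Then $m$ is even, and for any $0\le i_1<i_2\le m-1$, all possible edges are present between $Q_{i_1}$ and $Q_{i_2}$ if $i_1+i_2\equiv\frac m2\pmod m$, and there are no edges between them otherwise. (2.1) If moreover $\frac m2$ is odd, then $Q_0,\dots,Q_{m-1}$ are independent sets; in particular, if $m=2$ then $Q=Q_0\cup Q_1$ induces a complete bipartite graph, and if $m\ge6$ then $Q_0\cup Q_{\frac m2},\dots,Q_{\frac{m-2}{4}}\cup Q_{\frac{m+2}{4}},Q_{\frac m2+1}\cup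 Q_{m-1},\dots,Q_{\frac{3m-2}{4}}\cup Q_{\frac{3m+2}{4}}$ induce $\frac m2$ complete bipartite graphs. (2.2) If moreover $\frac m2$ is even, then $Q_{m/4}$ and $Q_{3m/4}$ are cliques and all other $Q_i$ ($0\le i\le m-1$, $i\ne\frac m4,\frac{3m}4$) are independent sets; in particular, if $m=4$ then $Q_0\cup Q_2$ induces a complete bipartite graph, and if $m\ge8$ then $Q_0\cup Q_{\frac m2},\dots,Q_{\frac{m-4}{4}}\cup Q_{\frac{m+4}{4}},Q_{\frac m2+1}\cup Q_{m-1},\dots,Q_{\frac{3m-4}{4}}\cup Q_{\frac{3m+4}{4}}$ induce $\frac{m-2}{2}$ complete bipartite graphs.
   Context: The generalised Paley graph $\mathrm{GP}(q^2,m)$ has vertex set $\mathbb{F}_{q^2}$, with two distinct vertices $x,y$ adjacent iff $x-y$ is an $m$-th power of an element of $\mathbb{F}_{q^2}^*$. Fix a primitive element $\beta$ of $\mathbb{F}_{q^2}$, let $\omega=\beta^{q-1}$, $Q=\langle\omega\rangle$ (subgroup of order $q+1$ of $\mathbb{F}_{q^2}^*$), $Q_0=\langle\omega^m\rangle$, and $Q_i=\omega^iQ_0$ for $0\le i\le m-1$. -}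

module Defs where

open import Level using (0ℓ)
open import Algebra.Bundles using (CommutativeRing)
open import Data.Nat using (ℕ; zero; suc; _<_)
import Data.Nat as ℕ
open import Data.Nat.Primality using (Prime)
open import Data.Fin using (Fin)
open import Data.Product using (Σ; ∃; _×_)
open import Relation.Nullary using (¬_; Dec)
open import Relation.Binary.PropositionalEquality using (_≡_)

IsPrimePower : ℕ → Set
IsPrimePower q = Σ ℕ λ p → Σ ℕ λ k → Prime p × (0 < k) × (q ≡ p ℕ.^ k)

record Field : Set₁ where
  field
    ring : CommutativeRing 0ℓ 0ℓ
  open CommutativeRing ring public
    using (Carrier; _≈_; _+_; _*_; -_; _-_; 0#; 1#)
  field
    _≟_     : (x y : Carrier) → Dec (x ≈ y)
    1≉0     : ¬ (1# ≈ 0#)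
    inverse : (x : Carrier) → ¬ (x ≈ 0#) → Σ Carrier λ y → x * y ≈ 1#

module _ (F : Field) where
  open Field F

  pow : Carrier → ℕ → Carrier
  pow x zero    = 1#
  pow x (suc n) = x * pow x n

  HasCardinality : ℕ → Set
  HasCardinality n = Σ (Fin n → Carrier) λ e →
      (∀ i j → e i ≈ e j → i ≡ j) × (∀ x → ∃ λ i → e i ≈ x)

  Primitive : Carrier → Set
  Primitive β = ¬ (β ≈ 0#) × (∀ x → ¬ (x ≈ 0#) → ∃ λ k → pow β k ≈ x)

  Adj : ℕ → Carrier → Carrier → Set
  Adj m x y = ¬ (x ≈ y) × (Σ Carrier λ z → ¬ (z ≈ 0#) × (pow z m ≈ x - y))

  InQ : Carrier → Carrier → Set
  InQ ω x = ∃ λ j → x ≈ pow ω j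

  InQi : Carrier → ℕ → ℕ → Carrier → Set
  InQi ω m i x = ∃ λ j → x ≈ pow ω i * pow (pow ω m) j

  AllEdges : Carrier → ℕ → ℕ → ℕ → Set
  AllEdges ω m a b = ∀ x y → InQi ω m a x → InQi ω m b y → Adj m x y

  NoEdges : Carrier → ℕ → ℕ → ℕ → Set
  NoEdges ω m a b = ∀ x y → InQi ω m a x → InQi ω m b y → ¬ Adj m x y

  Clique : Carrier → ℕ → ℕ → Set
  Clique ω m a = ∀ x y → InQi ω m a x → InQi ω m a y → ¬ (x ≈ y) → Adj m x y

  Independent : Carrier → ℕ → ℕ → Set
  Independent ω m a = ∀ x y → InQi ω m a x → InQi ω m a y → ¬ Adj m x y

  CompleteBipartite : Carrier → ℕ → ℕ → ℕ → Set
  CompleteBipartite ω m a b =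
    Independent ω m a × Independent ω m b × AllEdges ω m a b

-- Put ω = β ^ (q - 1), so Q = ⟨ω⟩ is the group of (q + 1)-th roots of unity, on which the
-- Frobenius map x ↦ x ^ q is inversion.  If ωᴬ - ωᴮ = βᴷ, raising to the q-th power gives
-- β ^ (K q) = - βᴷ / (ωᴬ ωᴮ), and comparing exponents modulo q² - 1 yields
-- A + B + K ≡ (q + 1) / 2 (mod q + 1).  So for x ∈ Q_i and y ∈ Q_j the difference x - y is an
-- m-th power, i.e. K ≡ 0 (mod m), exactly when i + j ≡ (q + 1) / 2 (mod m); each part of the
-- theorem then reduces to deciding which sums i + j, and which doubles i + i, hit that residue.
module Submission where

open import Defs
open import Data.Nat as ℕ using (ℕ; suc; NonZero)
open import Data.Nat.Divisibility using (_∣_)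
open import Data.Nat.Primality using (Prime)
open import Relation.Binary.PropositionalEquality using (_≡_)
open import Relation.Nullary using (¬_)

module FieldArithmetic (F : Field) where
  open import Algebra.Bundles using (CommutativeRing)
  open import Data.Nat as ℕ using (ℕ; zero; suc; _<_)
  import Data.Nat.Properties as ℕ
  open import Data.Product using (_,_)
  open import Function using (_∘_)
  open import Relation.Binary.PropositionalEquality using (cong)
  open import Relation.Nullary using (yes; no; contradiction)

  open Field F public
  open CommutativeRing ring public
    using ( refl; sym; trans; setoid; _≉_; semiring; commutativeSemiring; +-commutativeMonoid
          ; +-assoc; +-comm; +-identityˡ; +-identityʳ; -‿inverseˡ; -‿inverseʳ
          ; *-assoc; *-comm; *-identityˡ; *-identityʳ; distribˡ; distribʳ; zeroˡ; zeroʳ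
          ; +-cong; +-congˡ; +-congʳ; *-cong; *-congˡ; *-congʳ; -‿cong )
  open CommutativeRing ring using (+-group; +-abelianGroup)
  open import Relation.Binary.Reasoning.Setoid setoid public
  open import Algebra.Properties.Ring (CommutativeRing.ring ring) public
    using (-‿distribʳ-*; -1*x≈-x)
  open import Algebra.Properties.Group +-group
    using (loop; x∙y⁻¹≈ε⇒x≈y; inverseˡ-unique; //-rightDividesˡ; //-rightDividesʳ)
  open import Algebra.Properties.Loop loop using (identityʳ-unique)
  open import Algebra.Properties.AbelianGroup +-abelianGroup using (⁻¹-anti-homo‿-)
  open import Algebra.Properties.Semiring.Exp semiring using (_^_; ^-homo-*; ^-assocʳ; ^-congˡ)

  pow≈^ : ∀ x n → pow F x n ≈ x ^ n
  pow≈^ x zero    = refl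
  pow≈^ x (suc n) = *-congˡ (pow≈^ x n)

  pow-homo-* : ∀ x a b → pow F x (a ℕ.+ b) ≈ pow F x a * pow F x b
  pow-homo-* x a b = begin
    pow F x (a ℕ.+ b)      ≈⟨ pow≈^ x (a ℕ.+ b) ⟩
    x ^ (a ℕ.+ b)          ≈⟨ ^-homo-* x a b ⟩
    x ^ a * x ^ b          ≈⟨ *-cong (pow≈^ x a) (pow≈^ x b) ⟨
    pow F x a * pow F x b  ∎

  pow-assocʳ : ∀ x a b → pow F (pow F x a) b ≈ pow F x (a ℕ.* b)
  pow-assocʳ x a b = begin
    pow F (pow F x a) b  ≈⟨ pow≈^ (pow F x a) b ⟩
    pow F x a ^ b        ≈⟨ ^-congˡ b (pow≈^ x a) ⟩
    (x ^ a) ^ b          ≈⟨ ^-assocʳ x a b ⟩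
    x ^ (a ℕ.* b)        ≈⟨ pow≈^ x (a ℕ.* b) ⟨
    pow F x (a ℕ.* b)    ∎

  pow-congˡ : ∀ {x y} n → x ≈ y → pow F x n ≈ pow F y n
  pow-congˡ zero    _   = refl
  pow-congˡ (suc n) x≈y = *-cong x≈y (pow-congˡ n x≈y)

  1#-pow : ∀ n → pow F 1# n ≈ 1#
  1#-pow zero    = refl
  1#-pow (suc n) = trans (*-identityˡ _) (1#-pow n)

  pow≈1⇒pow-*≈1 : ∀ {x d} k → pow F x d ≈ 1# → pow F x (k ℕ.* d) ≈ 1#
  pow≈1⇒pow-*≈1 {x} {d} k xᵈ≈1 = begin
    pow F x (k ℕ.* d)    ≡⟨ cong (pow F x) (ℕ.*-comm k d) ⟩
    pow F x (d ℕ.* k)    ≈⟨ pow-assocʳ x d k ⟨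
    pow F (pow F x d) k  ≈⟨ pow-congˡ k xᵈ≈1 ⟩
    pow F 1# k           ≈⟨ 1#-pow k ⟩
    1#                   ∎

  0#-pow : ∀ n → 0 < n → pow F 0# n ≈ 0#
  0#-pow (suc n) _ = zeroˡ _

  *-cancelˡ : ∀ {x y z} → x ≉ 0# → x * y ≈ x * z → y ≈ z
  *-cancelˡ {x} {y} {z} x≉0 xy≈xz with inverse x x≉0
  ... | x⁻¹ , xx⁻¹≈1 = begin
    y              ≈⟨ cancel y ⟨
    x⁻¹ * (x * y)  ≈⟨ *-congˡ xy≈xz ⟩
    x⁻¹ * (x * z)  ≈⟨ cancel z ⟩
    z              ∎
    where
    cancel : ∀ u → x⁻¹ * (x * u) ≈ u
    cancel u = begin
      x⁻¹ * (x * u)  ≈⟨ *-assoc x⁻¹ x u ⟨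
      (x⁻¹ * x) * u  ≈⟨ *-congʳ (trans (*-comm x⁻¹ x) xx⁻¹≈1) ⟩
      1# * u         ≈⟨ *-identityˡ u ⟩
      u              ∎

  x*y≉0 : ∀ {x y} → x ≉ 0# → y ≉ 0# → x * y ≉ 0#
  x*y≉0 {x} x≉0 y≉0 xy≈0 = y≉0 (*-cancelˡ x≉0 (trans xy≈0 (sym (zeroʳ x))))

  pow-≉0 : ∀ {x} n → x ≉ 0# → pow F x n ≉ 0#
  pow-≉0 zero    _   = 1≉0
  pow-≉0 (suc n) x≉0 = x*y≉0 x≉0 (pow-≉0 n x≉0)

  pow≈0⇒≈0 : ∀ {x} n → pow F x n ≈ 0# → x ≈ 0#
  pow≈0⇒≈0 {x} n xⁿ≈0 with x ≟ 0#
  ... | yes x≈0 = x≈0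
  ... | no  x≉0 = contradiction xⁿ≈0 (pow-≉0 n x≉0)

  x-y≈0⇒x≈y : ∀ {x y} → x - y ≈ 0# → x ≈ y
  x-y≈0⇒x≈y = x∙y⁻¹≈ε⇒x≈y _ _

  x+y≈0⇒x≈-y : ∀ {x y} → x + y ≈ 0# → x ≈ - y
  x+y≈0⇒x≈-y = inverseˡ-unique _ _

  x≈x+y⇒y≈0 : ∀ {x y} → x ≈ x + y → y ≈ 0#
  x≈x+y⇒y≈0 x≈x+y = identityʳ-unique _ _ (sym x≈x+y)

  x-c+c≈x : ∀ x c → (x - c) + c ≈ x
  x-c+c≈x x c = //-rightDividesˡ c x

  x+c-c≈x : ∀ x c → (x + c) - c ≈ x
  x+c-c≈x x c = //-rightDividesʳ c x

  inverse-difference : ∀ {x x′ y y′} → x * x′ ≈ 1# → y * y′ ≈ 1# → (x * y) * (x′ - y′) ≈ y - x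
  inverse-difference {x} {x′} {y} {y′} xx′≈1 yy′≈1 = begin
    (x * y) * (x′ - y′)                  ≈⟨ distribˡ (x * y) x′ (- y′) ⟩
    (x * y) * x′ + (x * y) * - y′        ≈⟨ +-congˡ (-‿distribʳ-* (x * y) y′) ⟨
    (x * y) * x′ - (x * y) * y′
      ≈⟨ +-cong (trans (*-congʳ (*-comm x y)) (*-assoc y x x′)) (-‿cong (*-assoc x y y′)) ⟩
    y * (x * x′) - x * (y * y′)          ≈⟨ +-cong (*-congˡ xx′≈1) (-‿cong (*-congˡ yy′≈1)) ⟩
    y * 1# - x * 1#                      ≈⟨ +-cong (*-identityʳ y) (-‿cong (*-identityʳ x)) ⟩
    y - x                                ∎

  y-x≈-[x-y] : ∀ x y → y - x ≈ - (x - y)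
  y-x≈-[x-y] x y = sym (⁻¹-anti-homo‿- x y)

  [z+1][z-1]≈z²-1 : ∀ z → (z + 1#) * (z - 1#) ≈ z * z - 1#
  [z+1][z-1]≈z²-1 z = begin
    (z + 1#) * (z - 1#)             ≈⟨ distribʳ (z - 1#) z 1# ⟩
    z * (z - 1#) + 1# * (z - 1#)    ≈⟨ +-cong (distribˡ z z (- 1#)) (*-identityˡ _) ⟩
    (z * z + z * - 1#) + (z - 1#)
      ≈⟨ +-congʳ (+-congˡ (trans (-‿cong (sym (*-identityʳ z))) (-‿distribʳ-* z 1#))) ⟨
    (z * z - z) + (z - 1#)          ≈⟨ +-assoc (z * z) (- z) (z - 1#) ⟩
    z * z + (- z + (z - 1#))        ≈⟨ +-congˡ (+-assoc (- z) z (- 1#)) ⟨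
    z * z + ((- z + z) - 1#)        ≈⟨ +-congˡ (trans (+-congʳ (-‿inverseˡ z)) (+-identityˡ _)) ⟩
    z * z - 1#                      ∎

  z²≈1∧z≉1⇒z≈-1 : ∀ {z} → z * z ≈ 1# → z ≉ 1# → z ≈ - 1#
  z²≈1∧z≉1⇒z≈-1 {z} z²≈1 z≉1 = x+y≈0⇒x≈-y z+1≈0
    where
    z+1≈0 : z + 1# ≈ 0#
    z+1≈0 with (z + 1#) ≟ 0#
    ... | yes z+1≈0 = z+1≈0
    ... | no  z+1≉0 = contradiction
      (trans ([z+1][z-1]≈z²-1 z) (trans (+-congʳ z²≈1) (-‿inverseʳ 1#)))
      (x*y≉0 z+1≉0 (z≉1 ∘ x-y≈0⇒x≈y))

module NatCongruence where
  open import Data.Nat using (ℕ; _+_; _*_; _∸_; _<_; NonZero)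
  open import Data.Nat.Properties
    using ( <-irrefl; <-trans; +-identityʳ; +-assoc; *-assoc; *-distribʳ-∸; m+n∸n≡m; +-cancelˡ-≡; *-cancelˡ-≡
          ; +-commutativeSemigroup )
  open import Algebra.Properties.CommutativeSemigroup +-commutativeSemigroup using (xy∙z≈xz∙y)
  open import Data.Nat.DivMod using (_%_; _/_; m≡m%n+[m/n]*n; [m+kn]%n≡m%n; m<n⇒m%n≡m)
  open import Data.Nat.Divisibility using (_∣_; divides)
  open import Data.Product using (∃₂; _,_)
  open import Data.List using (_∷_; [])
  open import Relation.Nullary using (¬_)
  open import Relation.Binary.PropositionalEquality
  open import Data.Nat.Tactic.RingSolver using (solve)
  open ≡-Reasoning

  infix 4 _≡_mod_
  _≡_mod_ : ℕ → ℕ → ℕ → Set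
  x ≡ y mod n = ∃₂ λ i j → x + i * n ≡ y + j * n

  mod-refl : ∀ {n} x → x ≡ x mod n
  mod-refl x = 0 , 0 , refl

  mod-sym : ∀ {n x y} → x ≡ y mod n → y ≡ x mod n
  mod-sym (i , j , e) = j , i , sym e

  mod-trans : ∀ {n x y z} → x ≡ y mod n → y ≡ z mod n → x ≡ z mod n
  mod-trans {n} {x} {y} {z} (i , j , x≡y) (i′ , j′ , y≡z) = i + i′ , j′ + j , (begin
    x + (i + i′) * n      ≡⟨ solve (x ∷ i ∷ i′ ∷ n ∷ []) ⟩
    (x + i * n) + i′ * n  ≡⟨ cong (_+ i′ * n) x≡y ⟩
    (y + j * n) + i′ * n  ≡⟨ solve (y ∷ j ∷ i′ ∷ n ∷ []) ⟩
    (y + i′ * n) + j * n  ≡⟨ cong (_+ j * n) y≡z ⟩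
    (z + j′ * n) + j * n  ≡⟨ solve (z ∷ j′ ∷ j ∷ n ∷ []) ⟩
    z + (j′ + j) * n      ∎)

  x+k*n≡x : ∀ {n} x k → x + k * n ≡ x mod n
  x+k*n≡x x k = 0 , k , +-identityʳ _

  x+n≡x : ∀ {n} x → x + n ≡ x mod n
  x+n≡x x = 0 , 1 , +-assoc x _ 0

  ∣⇒≡0 : ∀ {n x} → n ∣ x → x ≡ 0 mod n
  ∣⇒≡0 {x = x} (divides k x≡k*n) = 0 , k , trans (+-identityʳ x) x≡k*n

  ≡0⇒∣ : ∀ {n x} → x ≡ 0 mod n → n ∣ x
  ≡0⇒∣ {n} {x} (i , j , e) = divides (j ∸ i) (begin
    x                  ≡⟨ m+n∸n≡m x (i * n) ⟨
    x + i * n ∸ i * n  ≡⟨ cong (_∸ i * n) e ⟩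
    j * n ∸ i * n      ≡⟨ *-distribʳ-∸ n j i ⟨
    (j ∸ i) * n        ∎)

  ≡-mod-∣ : ∀ {n d x y} → d ∣ n → x ≡ y mod n → x ≡ y mod d
  ≡-mod-∣ {x = x} {y} (divides c refl) (i , j , e) = i * c , j * c ,
    trans (cong (x +_) (*-assoc i c _)) (trans e (cong (y +_) (sym (*-assoc j c _))))

  +-mod : ∀ {n x y u v} → x ≡ y mod n → u ≡ v mod n → x + u ≡ y + v mod n
  +-mod {n} {x} {y} {u} {v} (i , j , x≡y) (i′ , j′ , u≡v) = i + i′ , j + j′ , (begin
    x + u + (i + i′) * n        ≡⟨ solve (x ∷ u ∷ i ∷ i′ ∷ n ∷ []) ⟩
    (x + i * n) + (u + i′ * n)  ≡⟨ cong₂ _+_ x≡y u≡v ⟩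
    (y + j * n) + (v + j′ * n)  ≡⟨ solve (y ∷ v ∷ j ∷ j′ ∷ n ∷ []) ⟩
    y + v + (j + j′) * n        ∎)

  +-cancelˡ-mod : ∀ {n x y} k → k + x ≡ k + y mod n → x ≡ y mod n
  +-cancelˡ-mod {n} {x} {y} k (i , j , e) =
    i , j , +-cancelˡ-≡ k _ _ (trans (sym (+-assoc k x (i * n))) (trans e (+-assoc k y (j * n))))

  *-cancelˡ-mod : ∀ {n x y} a .{{_ : NonZero a}} → a * x ≡ a * y mod a * n → x ≡ y mod n
  *-cancelˡ-mod {n} {x} {y} a (i , j , e) = i , j , *-cancelˡ-≡ _ _ a (begin
    a * (x + i * n)      ≡⟨ solve (a ∷ x ∷ i ∷ n ∷ []) ⟩
    a * x + i * (a * n)  ≡⟨ e ⟩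
    a * y + j * (a * n)  ≡⟨ solve (a ∷ y ∷ j ∷ n ∷ []) ⟩
    a * (y + j * n)      ∎)

  x+k≡x⇒k≡0 : ∀ {n x k} → x + k ≡ x mod n → k ≡ 0 mod n
  x+k≡x⇒k≡0 {n} {x} x+k≡x = +-cancelˡ-mod x (subst (λ y → x + _ ≡ y mod n) (sym (+-identityʳ x)) x+k≡x)

  module _ {n} .{{_ : NonZero n}} where

    ≡-mod⇒%≡ : ∀ {x y} → x ≡ y mod n → x % n ≡ y % n
    ≡-mod⇒%≡ {x} {y} (i , j , e) =
      trans (sym ([m+kn]%n≡m%n x i n)) (trans (cong (_% n) e) ([m+kn]%n≡m%n y j n))

    %≡⇒≡-mod : ∀ {x y} → x % n ≡ y % n → x ≡ y mod n
    %≡⇒≡-mod {x} {y} e = y / n , x / n , (begin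
      x + y / n * n                  ≡⟨ cong (_+ y / n * n) (m≡m%n+[m/n]*n x n) ⟩
      x % n + x / n * n + y / n * n  ≡⟨ cong (λ r → r + x / n * n + y / n * n) e ⟩
      y % n + x / n * n + y / n * n  ≡⟨ xy∙z≈xz∙y (y % n) _ _ ⟩
      y % n + y / n * n + x / n * n  ≡⟨ cong (_+ x / n * n) (m≡m%n+[m/n]*n y n) ⟨
      y + x / n * n                  ∎)

    ≡-mod-<⇒≡ : ∀ {x y} → x ≡ y mod n → x < n → y < n → x ≡ y
    ≡-mod-<⇒≡ x≡y x<n y<n =
      trans (sym (m<n⇒m%n≡m x<n)) (trans (≡-mod⇒%≡ x≡y) (m<n⇒m%n≡m y<n))

    <⇒≢-mod : ∀ {x y} → x < y → y < n → ¬ x ≡ y mod n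
    <⇒≢-mod x<y y<n x≡y = <-irrefl (≡-mod-<⇒≡ x≡y (<-trans x<y y<n) y<n) x<y

module PrimitiveElement (F : Field) (N : ℕ) .{{_ : NonZero N}} (card : HasCardinality F (suc N))
                        (β : Field.Carrier F) (prim : Primitive F β) where
  open import Data.Nat as ℕ using (ℕ; suc; NonZero; _≤_; _<_; _∸_; >-nonZero)
  import Data.Nat.Properties as ℕ
  open import Data.Nat.DivMod using (_%_; _/_; m%n<n; m≡m%n+[m/n]*n)
  open import Data.Fin as Fin using (Fin; toℕ; fromℕ; fromℕ<; inject₁; punchOut)
  import Data.Fin.Properties as Fin
  open import Data.Product using (∃; _×_; _,_; proj₁; proj₂)
  open import Relation.Nullary using (Dec; yes; no; contradiction)
  open import Relation.Binary.Definitions using (tri<; tri≈; tri>)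
  open import Relation.Binary.PropositionalEquality as ≡ using (_≡_; _≢_)
  open FieldArithmetic F
  open NatCongruence

  private
    enum : Fin (suc N) → Carrier
    enum = proj₁ card

    enum-injective : ∀ i j → enum i ≈ enum j → i ≡ j
    enum-injective = proj₁ (proj₂ card)

    index : Carrier → Fin (suc N)
    index x = proj₁ (proj₂ (proj₂ card) x)

    enum-index : ∀ x → enum (index x) ≈ x
    enum-index x = proj₂ (proj₂ (proj₂ card) x)

    β≉0 : β ≉ 0#
    β≉0 = proj₁ prim

    log : ∀ x → x ≉ 0# → ℕ
    log x x≉0 = proj₁ (proj₂ prim x x≉0)

    pow-log : ∀ x x≉0 → pow F β (log x x≉0) ≈ x
    pow-log x x≉0 = proj₂ (proj₂ prim x x≉0)

  pow-% : ∀ d .{{_ : NonZero d}} → pow F β d ≈ 1# → ∀ k → pow F β k ≈ pow F β (k % d)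
  pow-% d βᵈ≈1 k = begin
    pow F β k                                ≡⟨ ≡.cong (pow F β) (m≡m%n+[m/n]*n k d) ⟩
    pow F β (k % d ℕ.+ k / d ℕ.* d)          ≈⟨ pow-homo-* β (k % d) _ ⟩
    pow F β (k % d) * pow F β (k / d ℕ.* d)  ≈⟨ *-congˡ (pow≈1⇒pow-*≈1 (k / d) βᵈ≈1) ⟩
    pow F β (k % d) * 1#                     ≈⟨ *-identityʳ _ ⟩
    pow F β (k % d)                          ∎

  pow≈pow⇒period : ∀ {a b} → a ≤ b → pow F β a ≈ pow F β b → pow F β (b ∸ a) ≈ 1#
  pow≈pow⇒period {a} {b} a≤b βᵃ≈βᵇ = sym (*-cancelˡ (pow-≉0 a β≉0) (begin
    pow F β a * 1#               ≈⟨ *-identityʳ _ ⟩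
    pow F β a                    ≈⟨ βᵃ≈βᵇ ⟩
    pow F β b                    ≡⟨ ≡.cong (pow F β) (ℕ.m+[n∸m]≡n a≤b) ⟨
    pow F β (a ℕ.+ (b ∸ a))      ≈⟨ pow-homo-* β a (b ∸ a) ⟩
    pow F β a * pow F β (b ∸ a)  ∎))

  -- An element is 0 or some β ^ (k % d), so F injects into Fin (suc d).
  private
    module Residues (d : ℕ) .{{_ : NonZero d}} (βᵈ≈1 : pow F β d ≈ 1#) where
      code : ∀ x → Dec (x ≈ 0#) → Fin (suc d)
      code x (yes _)   = fromℕ d
      code x (no  x≉0) = inject₁ (fromℕ< (m%n<n (log x x≉0) d))

      code-injective : ∀ x y x? y? → code x x? ≡ code y y? → x ≈ y
      code-injective x y (yes x≈0) (yes y≈0) _  = trans x≈0 (sym y≈0)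
      code-injective x y (yes _)   (no  _)   eq = contradiction eq Fin.fromℕ≢inject₁
      code-injective x y (no  _)   (yes _)   eq = contradiction (≡.sym eq) Fin.fromℕ≢inject₁
      code-injective x y (no  x≉0) (no  y≉0) eq = begin
        x                            ≈⟨ pow-log x x≉0 ⟨
        pow F β (log x x≉0)          ≈⟨ pow-% d βᵈ≈1 (log x x≉0) ⟩
        pow F β (log x x≉0 % d)      ≡⟨ ≡.cong (pow F β) same-residue ⟩
        pow F β (log y y≉0 % d)      ≈⟨ pow-% d βᵈ≈1 (log y y≉0) ⟨
        pow F β (log y y≉0)          ≈⟨ pow-log y y≉0 ⟩
        y                            ∎
        where
        same-residue : log x x≉0 % d ≡ log y y≉0 % d
        same-residue = ≡.trans (≡.sym (Fin.toℕ-fromℕ< _))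
          (≡.trans (≡.cong toℕ (Fin.inject₁-injective eq)) (Fin.toℕ-fromℕ< _))

      N≤d : N ≤ d
      N≤d with suc N ℕ.≤? suc d
      ... | yes N+1≤d+1 = ℕ.s≤s⁻¹ N+1≤d+1
      ... | no  N+1≰d+1 with Fin.pigeonhole (ℕ.≰⇒> N+1≰d+1) (λ i → code (enum i) (enum i ≟ 0#))
      ...   | i , j , i<j , same = contradiction
                (enum-injective i j (code-injective _ _ (enum i ≟ 0#) (enum j ≟ 0#) same))
                (Fin.<⇒≢ i<j)

  period-≥ : ∀ {d} → 0 < d → pow F β d ≈ 1# → N ≤ d
  period-≥ 0<d βᵈ≈1 = Residues.N≤d _ {{>-nonZero 0<d}} βᵈ≈1

  private
    index-0≢index-pow : ∀ (i : Fin (suc N)) → index 0# ≢ index (pow F β (toℕ i))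
    index-0≢index-pow i eq = pow-≉0 (toℕ i) β≉0 (begin
      pow F β (toℕ i)                ≈⟨ enum-index _ ⟨
      enum (index (pow F β (toℕ i))) ≡⟨ ≡.cong enum eq ⟨
      enum (index 0#)                ≈⟨ enum-index 0# ⟩
      0#                             ∎)

  -- The N + 1 powers β ^ 0 … β ^ N are among the N nonzero elements.
  period-≤ : ∃ λ d → 0 < d × d ≤ N × pow F β d ≈ 1#
  period-≤ with Fin.pigeonhole (ℕ.n<1+n N) (λ i → punchOut (index-0≢index-pow i))
  ... | i , j , i<j , same =
    toℕ j ∸ toℕ i , ℕ.m<n⇒0<n∸m i<j ,
    ℕ.≤-trans (ℕ.m∸n≤m (toℕ j) (toℕ i)) (ℕ.s≤s⁻¹ (Fin.toℕ<n j)) ,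
    pow≈pow⇒period (ℕ.<⇒≤ i<j) (begin
      pow F β (toℕ i)                 ≈⟨ enum-index _ ⟨
      enum (index (pow F β (toℕ i)))
        ≡⟨ ≡.cong enum (Fin.punchOut-injective (index-0≢index-pow i) (index-0≢index-pow j) same) ⟩
      enum (index (pow F β (toℕ j)))  ≈⟨ enum-index _ ⟩
      pow F β (toℕ j)                 ∎)

  pow-N≈1 : pow F β N ≈ 1#
  pow-N≈1 with period-≤
  ... | d , 0<d , d≤N , βᵈ≈1 =
    ≡.subst (λ n → pow F β n ≈ 1#) (ℕ.≤-antisym d≤N (period-≥ 0<d βᵈ≈1)) βᵈ≈1

  private
    pow-injective-<N : ∀ {a b} → a < N → b < N → pow F β a ≈ pow F β b → a ≡ b
    pow-injective-<N {a} {b} a<N b<N βᵃ≈βᵇ with ℕ.<-cmp a b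
    ... | tri≈ _ a≡b _ = a≡b
    ... | tri< a<b _ _ = contradiction
            (period-≥ (ℕ.m<n⇒0<n∸m a<b) (pow≈pow⇒period (ℕ.<⇒≤ a<b) βᵃ≈βᵇ))
            (ℕ.<⇒≱ (ℕ.≤-<-trans (ℕ.m∸n≤m b a) b<N))
    ... | tri> _ _ b<a = contradiction
            (period-≥ (ℕ.m<n⇒0<n∸m b<a) (pow≈pow⇒period (ℕ.<⇒≤ b<a) (sym βᵃ≈βᵇ)))
            (ℕ.<⇒≱ (ℕ.≤-<-trans (ℕ.m∸n≤m a b) a<N))

  pow-injective : ∀ a b → pow F β a ≈ pow F β b → a ≡ b mod N
  pow-injective a b βᵃ≈βᵇ = %≡⇒≡-mod (pow-injective-<N (m%n<n a N) (m%n<n b N) (begin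
    pow F β (a % N)  ≈⟨ pow-% N pow-N≈1 a ⟨
    pow F β a        ≈⟨ βᵃ≈βᵇ ⟩
    pow F β b        ≈⟨ pow-% N pow-N≈1 b ⟩
    pow F β (b % N)  ∎))

module Characteristic (F : Field) where
  open import Data.Nat as ℕ using (zero; suc)
  open import Data.Fin using (Fin)
  open import Data.Fin.Permutation using (Permutation; permutation)
  open import Data.Vec.Functional using (replicate)
  open import Data.Product using (_,_; proj₁; proj₂)
  open import Relation.Nullary using (yes; no; contradiction)
  open import Relation.Binary.PropositionalEquality using (_≡_)
  open FieldArithmetic F
  open import Algebra.Properties.CommutativeMonoid.Sum +-commutativeMonoid
    using (sum; sum-permute; sum-cong-≋; ∑-distrib-+; sum-replicate)
  open import Algebra.Properties.Semiring.Mult semiring using (_×_; ×1-homo-*)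

  -- Translation by 1 permutes F, so Σ x = Σ (x + 1) = Σ x + n × 1.
  characteristic : ∀ {n} → HasCardinality F n → n × 1# ≈ 0#
  characteristic {n} (enum , enum-injective , onto) = x≈x+y⇒y≈0 (begin
    sum enum                                ≈⟨ sum-permute enum (translation 1#) ⟩
    sum (λ i → enum (index (enum i + 1#)))  ≈⟨ sum-cong-≋ (λ i → enum-index (enum i + 1#)) ⟩
    sum (λ i → enum i + 1#)                 ≈⟨ ∑-distrib-+ enum (replicate n 1#) ⟩
    sum enum + sum (replicate n 1#)         ≈⟨ +-congˡ (sum-replicate n) ⟩
    sum enum + n × 1#                       ∎)
    where
    index : Carrier → Fin n
    index x = proj₁ (onto x)

    enum-index : ∀ x → enum (index x) ≈ x
    enum-index x = proj₂ (onto x)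

    translate : Carrier → Fin n → Fin n
    translate c i = index (enum i + c)

    translate-inverse : ∀ c i → translate c (translate (- c) i) ≡ i
    translate-inverse c i = enum-injective (translate c (translate (- c) i)) i
      (trans (enum-index _) (trans (+-congʳ (enum-index _)) (x-c+c≈x (enum i) c)))

    translate-inverse′ : ∀ c i → translate (- c) (translate c i) ≡ i
    translate-inverse′ c i = enum-injective (translate (- c) (translate c i)) i
      (trans (enum-index _) (trans (+-congʳ (enum-index _)) (x+c-c≈x (enum i) c)))

    translation : Carrier → Permutation n n
    translation c = permutation (translate c) (translate (- c))
      (translate-inverse c) (translate-inverse′ c)

  n²×1≈0⇒n×1≈0 : ∀ n → (n ℕ.* n) × 1# ≈ 0# → n × 1# ≈ 0#
  n²×1≈0⇒n×1≈0 n n²×1≈0 with (n × 1#) ≟ 0#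
  ... | yes n×1≈0 = n×1≈0
  ... | no  n×1≉0 = contradiction (trans (sym (×1-homo-* n n)) n²×1≈0) (x*y≉0 n×1≉0 n×1≉0)

  pᵏ×1≈0⇒p×1≈0 : ∀ p k → (p ℕ.^ k) × 1# ≈ 0# → p × 1# ≈ 0#
  pᵏ×1≈0⇒p×1≈0 p k pᵏ×1≈0 = pow≈0⇒≈0 k (trans (sym (pᵏ×1≈[p×1]ᵏ k)) pᵏ×1≈0)
    where
    pᵏ×1≈[p×1]ᵏ : ∀ k → (p ℕ.^ k) × 1# ≈ pow F (p × 1#) k
    pᵏ×1≈[p×1]ᵏ zero    = +-identityʳ 1#
    pᵏ×1≈[p×1]ᵏ (suc k) = trans (×1-homo-* p (p ℕ.^ k)) (*-congˡ (pᵏ×1≈[p×1]ᵏ k))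

  prime-power-characteristic : ∀ p k → HasCardinality F (p ℕ.^ k ℕ.* p ℕ.^ k) → p × 1# ≈ 0#
  prime-power-characteristic p k card =
    pᵏ×1≈0⇒p×1≈0 p k (n²×1≈0⇒n×1≈0 (p ℕ.^ k) (characteristic card))

module PrimeBinomial where
  open import Data.Nat as ℕ using (zero; suc; _!; _<_; _∸_)
  import Data.Nat.Properties as ℕ
  open import Data.Nat.Divisibility using (_∣_; ∣1⇒≡1; ∣⇒≤; m∣m*n)
  open import Data.Nat.DivMod using (m/n*n≡m)
  open import Data.Nat.Primality using (Prime; euclidsLemma; prime⇒nonTrivial; prime⇒nonZero)
  open import Data.Nat.Combinatorics using (_C_; k![n∸k]!∣n!)
  open import Data.Nat.Combinatorics.Specification using (nCk≡n!/k![n-k]!)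
  open import Data.Sum using (inj₁; inj₂)
  open import Relation.Nullary using (¬_; contradiction)
  open import Relation.Binary.PropositionalEquality using (cong; subst; sym; trans)

  n∣n! : ∀ {n} → 0 < n → n ∣ n !
  n∣n! {suc n} _ = m∣m*n (n !)

  prime∤! : ∀ {p} → Prime p → ∀ j → j < p → ¬ p ∣ j !
  prime∤! {p} p-prime zero    _   p∣1 =
    ℕ.<-irrefl (sym (∣1⇒≡1 p∣1)) (ℕ.nonTrivial⇒n>1 p {{prime⇒nonTrivial p-prime}})
  prime∤! p-prime (suc j) j<p p∣j! with euclidsLemma (suc j) (j !) p-prime p∣j!
  ... | inj₁ p∣1+j = ℕ.<⇒≱ j<p (∣⇒≤ p∣1+j)
  ... | inj₂ p∣j!  = prime∤! p-prime j (ℕ.<-trans (ℕ.n<1+n j) j<p) p∣j!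

  -- p divides p! = (p C k) · k! · (p ∸ k)! but neither factorial.
  prime∣pCk : ∀ {p k} → Prime p → 0 < k → k < p → p ∣ p C k
  prime∣pCk {p} {k} p-prime 0<k k<p
    with euclidsLemma (p C k) (k ! ℕ.* (p ∸ k) !) p-prime p∣product
    where
    instance _ = k ℕ.!* (p ∸ k) !≢0
    p∣product : p ∣ (p C k) ℕ.* (k ! ℕ.* (p ∸ k) !)
    p∣product = subst (p ∣_)
      (sym (trans (cong (ℕ._* (k ! ℕ.* (p ∸ k) !)) (nCk≡n!/k![n-k]! (ℕ.<⇒≤ k<p)))
                  (m/n*n≡m (k![n∸k]!∣n! (ℕ.<⇒≤ k<p)))))
      (n∣n! (ℕ.>-nonZero⁻¹ p {{prime⇒nonZero p-prime}}))
  ... | inj₁ p∣pCk = p∣pCk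
  ... | inj₂ p∣k![p∸k]! with euclidsLemma (k !) ((p ∸ k) !) p-prime p∣k![p∸k]!
  ...   | inj₁ p∣k!     = contradiction p∣k! (prime∤! p-prime k k<p)
  ...   | inj₂ p∣[p∸k]! = contradiction p∣[p∸k]!
          (prime∤! p-prime (p ∸ k) (ℕ.∸-monoʳ-< {p} {k} {0} 0<k (ℕ.<⇒≤ k<p)))

module Frobenius (F : Field) {p : ℕ} (p-prime : Prime p) where
  open import Data.Nat as ℕ using (zero; suc; _<_; z≤n; s≤s)
  import Data.Nat.Properties as ℕ
  open import Data.Nat.Divisibility using (divides)
  open import Data.Nat.Primality using (prime⇒nonZero)
  open import Data.Nat.Combinatorics using (_C_; nCn≡1; nCk≡nC[n∸k])
  open import Data.Fin as Fin using (toℕ; fromℕ)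
  import Data.Fin.Properties as Fin
  open import Data.Vec.Functional using (init; last; tail; replicate)
  open import Relation.Binary.PropositionalEquality as ≡ using (_≡_)
  open FieldArithmetic F
  open PrimeBinomial using (prime∣pCk)
  open import Algebra.Properties.Semiring.Mult semiring using (_×_; ×-assoc-*; ×-congʳ; ×-homo-1; ×1-homo-*)
  open import Algebra.Properties.Semiring.Sum semiring using (sum; sum-init-last; sum-cong-≋; sum-replicate-zero)
  open import Algebra.Properties.Semiring.Exp semiring using (_^_)
  import Algebra.Properties.CommutativeSemiring.Binomial commutativeSemiring as Binomial

  binomial-extremes : ∀ n .{{_ : ℕ.NonZero n}} →
    (∀ {i} z → 0 < i → i < n → (n C i) × z ≈ 0#) →
    ∀ x y → (x + y) ^ n ≈ x ^ n + y ^ n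
  binomial-extremes (suc n) middle≈0 x y = begin
    (x + y) ^ suc n                                       ≈⟨ Binomial.theorem (suc n) x y ⟩
    term Fin.zero + sum (tail term)                       ≈⟨ +-congˡ (sum-init-last (tail term)) ⟩
    term Fin.zero + (sum (init (tail term)) + last (tail term))
      ≈⟨ +-congˡ (trans (+-congʳ middle) (+-identityˡ _)) ⟩
    term Fin.zero + last (tail term)                      ≈⟨ +-cong first final ⟩
    y ^ suc n + x ^ suc n                                 ≈⟨ +-comm _ _ ⟩
    x ^ suc n + y ^ suc n                                 ∎
    where
    term = Binomial.binomialTerm x y (suc n)

    first : term Fin.zero ≈ y ^ suc n
    first = begin
      (suc n C 0) × (1# * y ^ suc n)
        ≡⟨ ≡.cong (_× (1# * y ^ suc n)) (≡.trans (nCk≡nC[n∸k] {0} {suc n} z≤n) (nCn≡1 (suc n))) ⟩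
      1 × (1# * y ^ suc n)            ≈⟨ ×-homo-1 _ ⟩
      1# * y ^ suc n                  ≈⟨ *-identityˡ _ ⟩
      y ^ suc n                       ∎

    final : last (tail term) ≈ x ^ suc n
    final = begin
      (n′ C toℕ (fromℕ n′)) × (x ^ toℕ (fromℕ n′) * y ^ (n′ ℕ.∸ toℕ (fromℕ n′)))
        ≡⟨ ≡.cong (λ k → (n′ C k) × (x ^ k * y ^ (n′ ℕ.∸ k))) (Fin.toℕ-fromℕ n′) ⟩
      (n′ C n′) × (x ^ n′ * y ^ (n′ ℕ.∸ n′))
        ≡⟨ ≡.cong₂ (λ c k → c × (x ^ n′ * y ^ k)) (nCn≡1 n′) (ℕ.n∸n≡0 n′) ⟩
      1 × (x ^ n′ * 1#)  ≈⟨ trans (×-homo-1 _) (*-identityʳ _) ⟩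
      x ^ n′             ∎
      where n′ = suc n

    middle : sum (init (tail term)) ≈ 0#
    middle = trans (sum-cong-≋ {y = replicate n 0#} vanishes) (sum-replicate-zero n)
      where
      vanishes : ∀ j → init (tail term) j ≈ 0#
      vanishes j = middle≈0 _ (s≤s z≤n)
        (s≤s (≡.subst (ℕ._< n) (≡.sym (Fin.toℕ-inject₁ j)) (Fin.toℕ<n j)))

  ×1≈0⇒×≈0 : ∀ {n} z → n × 1# ≈ 0# → n × z ≈ 0#
  ×1≈0⇒×≈0 {n} z n×1≈0 = begin
    n × z         ≈⟨ ×-congʳ n (*-identityˡ z) ⟨
    n × (1# * z)  ≈⟨ ×-assoc-* n 1# z ⟨
    (n × 1#) * z  ≈⟨ *-congʳ n×1≈0 ⟩
    0# * z        ≈⟨ zeroˡ z ⟩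
    0#            ∎

  module _ (p×1≈0 : p × 1# ≈ 0#) where

    pCk×z≈0 : ∀ {k} z → 0 < k → k < p → (p C k) × z ≈ 0#
    pCk×z≈0 {k} z 0<k k<p with prime∣pCk p-prime 0<k k<p
    ... | divides c pCk≡c*p = ×1≈0⇒×≈0 {p C k} z (begin
      (p C k) × 1#         ≡⟨ ≡.cong (_× 1#) pCk≡c*p ⟩
      (c ℕ.* p) × 1#       ≈⟨ ×1-homo-* c p ⟩
      (c × 1#) * (p × 1#)  ≈⟨ *-congˡ p×1≈0 ⟩
      (c × 1#) * 0#        ≈⟨ zeroʳ _ ⟩
      0#                   ∎)

    pow-p-homo-+ : ∀ x y → pow F (x + y) p ≈ pow F x p + pow F y p
    pow-p-homo-+ x y = begin
      pow F (x + y) p        ≈⟨ pow≈^ (x + y) p ⟩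
      (x + y) ^ p            ≈⟨ binomial-extremes p {{prime⇒nonZero p-prime}} pCk×z≈0 x y ⟩
      x ^ p + y ^ p          ≈⟨ +-cong (pow≈^ x p) (pow≈^ y p) ⟨
      pow F x p + pow F y p  ∎

    pow-pᵏ-homo-+ : ∀ k x y → pow F (x + y) (p ℕ.^ k) ≈ pow F x (p ℕ.^ k) + pow F y (p ℕ.^ k)
    pow-pᵏ-homo-+ zero    x y = trans (*-identityʳ _) (sym (+-cong (*-identityʳ x) (*-identityʳ y)))
    pow-pᵏ-homo-+ (suc k) x y = begin
      pow F (x + y) (p ℕ.* p ℕ.^ k)                               ≈⟨ pow-assocʳ (x + y) p _ ⟨
      pow F (pow F (x + y) p) (p ℕ.^ k)                           ≈⟨ pow-congˡ (p ℕ.^ k) (pow-p-homo-+ x y) ⟩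
      pow F (pow F x p + pow F y p) (p ℕ.^ k)                     ≈⟨ pow-pᵏ-homo-+ k _ _ ⟩
      pow F (pow F x p) (p ℕ.^ k) + pow F (pow F y p) (p ℕ.^ k)
        ≈⟨ +-cong (pow-assocʳ x p _) (pow-assocʳ y p _) ⟩
      pow F x (p ℕ.* p ℕ.^ k) + pow F y (p ℕ.* p ℕ.^ k)           ∎

    pow-pᵏ-homo-- : ∀ k x y → pow F (x - y) (p ℕ.^ k) ≈ pow F x (p ℕ.^ k) - pow F y (p ℕ.^ k)
    pow-pᵏ-homo-- k x y = trans (pow-pᵏ-homo-+ k x (- y)) (+-congˡ (x+y≈0⇒x≈-y (begin
      pow F (- y) q + pow F y q  ≈⟨ pow-pᵏ-homo-+ k (- y) y ⟨
      pow F (- y + y) q          ≈⟨ pow-congˡ q (-‿inverseˡ y) ⟩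
      pow F 0# q                 ≈⟨ 0#-pow q (ℕ.m^n>0 p {{prime⇒nonZero p-prime}} k) ⟩
      0#                         ∎)))
      where q = p ℕ.^ k

module NatArithmetic where
  open import Data.Nat using (zero; suc; _+_; _*_; _∸_; _≤_; _<_; z≤n; s≤s)
  import Data.Nat.Properties as ℕ
  open import Data.Nat.DivMod using (_/_; m/n*n≤m)
  open import Data.Nat.Divisibility using (divides; ∣-refl; ∣m∣n⇒∣m+n; _∣0; _∣?_)
  open import Data.Nat.Primality using (euclidsLemma; prime[2])
  open import Data.Nat.Tactic.RingSolver using (solve-∀)
  open import Data.Product using (∃; _×_; _,_)
  open import Data.Sum using (_⊎_; inj₁; inj₂)
  open import Function using (_∘_)
  open import Relation.Nullary using (yes; no; contradiction)
  open import Relation.Binary.PropositionalEquality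
  open ≡-Reasoning
  open NatCongruence

  ¬2∣n⇒2∣1+n : ∀ n → ¬ 2 ∣ n → 2 ∣ suc n
  ¬2∣n⇒2∣1+n zero          ¬2∣0   = contradiction (2 ∣0) ¬2∣0
  ¬2∣n⇒2∣1+n (suc zero)    _      = divides 1 refl
  ¬2∣n⇒2∣1+n (suc (suc n)) ¬2∣2+n =
    ∣m∣n⇒∣m+n ∣-refl (¬2∣n⇒2∣1+n n (¬2∣2+n ∘ ∣m∣n⇒∣m+n ∣-refl))

  n*2≡n+n : ∀ n → n * 2 ≡ n + n
  n*2≡n+n n = trans (ℕ.*-comm n 2) (cong (n +_) (ℕ.+-identityʳ n))

  2∣n+n : ∀ n → 2 ∣ n + n
  2∣n+n n = divides n (sym (n*2≡n+n n))

  n+n≡m+m⇒n≡m : ∀ {n m} → n + n ≡ m + m → n ≡ m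
  n+n≡m+m⇒n≡m {n} {m} e = ℕ.*-cancelʳ-≡ n m 2 (trans (n*2≡n+n n) (trans e (sym (n*2≡n+n m))))

  0<m*n⇒0<m : ∀ {m} n → 0 < m * n → 0 < m
  0<m*n⇒0<m {suc m} _ _ = s≤s z≤n

  ≤∸1⇒< : ∀ {k n} → 0 < n → k ≤ n ∸ 1 → k < n
  ≤∸1⇒< {n = suc n} _ k≤n = s≤s k≤n

  k+k<n⇒k<n∸k : ∀ k {n} → k + k < n → k < n ∸ k
  k+k<n⇒k<n∸k k k+k<n = ℕ.m+n≤o⇒m≤o∸n (suc k) k+k<n

  ≤/⇒*≤ : ∀ {k x d} .{{_ : NonZero d}} → k ≤ x / d → k * d ≤ x
  ≤/⇒*≤ {k} {x} {d} k≤x/d = ℕ.≤-trans (ℕ.*-monoˡ-≤ d k≤x/d) (m/n*n≤m x d)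

  half-bound : ∀ {k x} → 0 < x → k ≤ (x ∸ 1) / 2 → k + k < x
  half-bound {k} {x} 0<x k≤ = ≤∸1⇒< 0<x (subst (_≤ x ∸ 1) (n*2≡n+n k) (≤/⇒*≤ {k} {x ∸ 1} {2} k≤))

  quarter-bound : ∀ {k x} → 0 < x → k ≤ (x * 2 ∸ 2) / 4 → k + k < x
  quarter-bound {k} {x} 0<x k≤ = ≤∸1⇒< 0<x (ℕ.*-cancelʳ-≤ (k + k) (x ∸ 1) 2
    (subst₂ _≤_ (four k) (sym (ℕ.*-distribʳ-∸ 2 x 1)) (≤/⇒*≤ k≤)))
    where
    four : ∀ k → k * 4 ≡ (k + k) * 2
    four = solve-∀

  quarter-bound′ : ∀ {k x} → 0 < x → k ≤ (x * 4 ∸ 4) / 4 → k < x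
  quarter-bound′ {k} {x} 0<x k≤ = ≤∸1⇒< 0<x (ℕ.*-cancelʳ-≤ k (x ∸ 1) 4
    (subst (k * 4 ≤_) (sym (ℕ.*-distribʳ-∸ 4 x 1)) (≤/⇒*≤ k≤)))

  module _ {m} .{{_ : NonZero m}} where

    double-residue : ∀ {i t} → i < m → t < m → i + i ≡ t mod m → i + i ≡ t ⊎ i + i ≡ t + m
    double-residue {i} {t} i<m t<m i+i≡t with i + i ℕ.<? m
    ... | yes i+i<m = inj₁ (≡-mod-<⇒≡ i+i≡t i+i<m t<m)
    ... | no  i+i≮m = inj₂ (trans (sym (ℕ.m∸n+n≡m m≤i+i)) (cong (_+ m) (≡-mod-<⇒≡ d≡t d<m t<m)))
      where
      m≤i+i : m ≤ i + i
      m≤i+i = ℕ.≮⇒≥ i+i≮m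

      d<m : i + i ∸ m < m
      d<m = ℕ.m<n+o⇒m∸n<o (i + i) m (ℕ.+-mono-< i<m i<m)

      d≡t : i + i ∸ m ≡ t mod m
      d≡t = mod-trans (mod-sym (x+n≡x _)) (subst (_≡ t mod m) (sym (ℕ.m∸n+n≡m m≤i+i)) i+i≡t)

    double≡0 : ∀ {i} → 0 < i → i < m → i + i ≡ 0 mod m → i + i ≡ m
    double≡0 {i} 0<i i<m i+i≡0 with double-residue i<m (ℕ.>-nonZero⁻¹ m) i+i≡0
    ... | inj₁ i+i≡0′ = contradiction (ℕ.m+n≡0⇒m≡0 i i+i≡0′) (ℕ.n>0⇒n≢0 0<i)
    ... | inj₂ i+i≡m  = i+i≡m

  -- c is odd (else m ∣ h), so Euclid gives m = 2 r, and then h = c r ≡ r (mod m).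
  ¬∣half⇒half-residue : ∀ {h c m} .{{_ : NonZero m}} → h * 2 ≡ c * m → ¬ m ∣ h →
                         ∃ λ r → (m ≡ r * 2) × (h ≡ r mod m)
  ¬∣half⇒half-residue {h} {c} {m} h*2≡c*m m∤h with 2 ∣? c
  ... | yes (divides d c≡d*2) = contradiction
    (divides d (ℕ.*-cancelʳ-≡ h (d * m) 2 (trans h*2≡c*m (trans (cong (_* m) c≡d*2) (swap d m)))))
    m∤h
    where
    swap : ∀ d m → d * 2 * m ≡ d * m * 2
    swap = solve-∀
  ... | no 2∤c with euclidsLemma c m prime[2] (divides h (sym h*2≡c*m))
  ...   | inj₁ 2∣c = contradiction 2∣c 2∤c
  ...   | inj₂ (divides r m≡r*2) with ¬2∣n⇒2∣1+n c 2∤c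
  ...     | divides e 1+c≡e*2 =
    r , m≡r*2 , +-cancelˡ-mod r (mod-trans (∣⇒≡0 (divides e r+h≡e*m)) (mod-sym r+r≡0))
    where
    h≡c*r : h ≡ c * r
    h≡c*r = ℕ.*-cancelʳ-≡ h (c * r) 2 (trans h*2≡c*m (trans (cong (c *_) m≡r*2) (sym (ℕ.*-assoc c r 2))))

    r+h≡e*m : r + h ≡ e * m
    r+h≡e*m = begin
      r + h         ≡⟨ cong (r +_) h≡c*r ⟩
      suc c * r     ≡⟨ cong (_* r) 1+c≡e*2 ⟩
      e * 2 * r     ≡⟨ reorder e r ⟩
      e * (r * 2)   ≡⟨ cong (e *_) m≡r*2 ⟨
      e * m         ∎
      where
      reorder : ∀ e r → e * 2 * r ≡ e * (r * 2)
      reorder = solve-∀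

    r+r≡0 : r + r ≡ 0 mod m
    r+r≡0 = subst (_≡ 0 mod m) (trans m≡r*2 (n*2≡n+n r)) (∣⇒≡0 ∣-refl)

module UnitCircle (F : Field) {p k : ℕ} (p-prime : Prime p) (0<k : 0 ℕ.< k)
                  (q : ℕ) (q≡pᵏ : q ≡ p ℕ.^ k) (q-odd : ¬ 2 ∣ q)
                  (card : HasCardinality F (q ℕ.* q))
                  (β : Field.Carrier F) (prim : Primitive F β) where
  open import Data.Nat as ℕ using (zero; _∸_; _≤_; _<_; z≤n; s≤s; >-nonZero)
  import Data.Nat.Properties as ℕ
  open import Data.Nat.DivMod using (_%_; _/_; m/n*n≡m; m≡m%n+[m/n]*n; m<n⇒m%n≡m)
  open import Data.Nat.Divisibility using (divides)
  open import Function using (_∘_)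
  open import Data.Nat.Primality using (prime⇒nonTrivial; prime⇒nonZero)
  open import Data.Nat.Tactic.RingSolver using (solve-∀)
  open import Data.Product using (Σ; ∃; _×_; _,_; proj₁; proj₂)
  open import Relation.Nullary using (contradiction)
  open import Relation.Binary.PropositionalEquality as ≡ using (_≢_; subst; subst₂)
  open FieldArithmetic F
  open NatCongruence
  open NatArithmetic
  open Characteristic F using (prime-power-characteristic)
  open Frobenius F p-prime using (pow-pᵏ-homo--)

  a : ℕ
  a = q ∸ 1

  ω : Carrier
  ω = pow F β a

  1<q : 1 < q
  1<q = subst (1 <_) (≡.sym q≡pᵏ) (ℕ.<-≤-trans (ℕ.nonTrivial⇒n>1 p {{prime⇒nonTrivial p-prime}})
          (subst (_≤ p ℕ.^ k) (ℕ.*-identityʳ p) (ℕ.^-monoʳ-≤ p {{prime⇒nonZero p-prime}} 0<k)))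

  q≡1+a : q ≡ suc a
  q≡1+a = ≡.sym (ℕ.suc-pred q {{>-nonZero (ℕ.<-trans ℕ.z<s 1<q)}})

  N : ℕ
  N = a ℕ.* (q ℕ.+ 1)

  instance
    a≢0 : NonZero a
    a≢0 = >-nonZero (ℕ.∸-monoˡ-< 1<q ℕ.≤-refl)
    N≢0 : NonZero N
    N≢0 = ℕ.m*n≢0 a (q ℕ.+ 1) {{a≢0}} {{subst NonZero (ℕ.+-comm 1 q) _}}

  1+N≡q² : suc N ≡ q ℕ.* q
  1+N≡q² = ≡.trans (≡.cong (λ n → suc (a ℕ.* (n ℕ.+ 1))) q≡1+a)
                   (≡.trans (square a) (≡.cong₂ ℕ._*_ (≡.sym q≡1+a) (≡.sym q≡1+a)))
    where
    square : ∀ a → suc (a ℕ.* (suc a ℕ.+ 1)) ≡ suc a ℕ.* suc a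
    square = solve-∀

  open PrimitiveElement F N (subst (HasCardinality F) (≡.sym 1+N≡q²) card) β prim public
    using (pow-N≈1; pow-injective; period-≥)

  h : ℕ
  h = (q ℕ.+ 1) / 2

  q+1≡h*2 : q ℕ.+ 1 ≡ h ℕ.* 2
  q+1≡h*2 = ≡.sym (m/n*n≡m (subst (2 ∣_) (ℕ.+-comm 1 q) (¬2∣n⇒2∣1+n q q-odd)))

  frobenius : ∀ x y → pow F (x - y) q ≈ pow F x q - pow F y q
  frobenius x y = subst (λ n → pow F (x - y) n ≈ pow F x n - pow F y n) (≡.sym q≡pᵏ)
    (pow-pᵏ-homo-- (prime-power-characteristic p k (subst (λ n → HasCardinality F (n ℕ.* n)) q≡pᵏ card)) k x y)

  -1≈β^[ah] : - 1# ≈ pow F β (a ℕ.* h)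
  -1≈β^[ah] = sym (z²≈1∧z≉1⇒z≈-1 z²≈1 z≉1)
    where
    z : Carrier
    z = pow F β (a ℕ.* h)

    0<h : 0 < h
    0<h with h | q+1≡h*2
    ... | zero  | q+1≡0 = contradiction q+1≡0 (ℕ.m+1+n≢0 q)
    ... | suc _ | _     = ℕ.z<s

    z²≈1 : z * z ≈ 1#
    z²≈1 = begin
      z * z                             ≈⟨ pow-homo-* β (a ℕ.* h) (a ℕ.* h) ⟨
      pow F β (a ℕ.* h ℕ.+ a ℕ.* h)
        ≡⟨ ≡.cong (pow F β) (≡.trans (double a h) (≡.cong (a ℕ.*_) (≡.sym q+1≡h*2))) ⟩
      pow F β N                         ≈⟨ pow-N≈1 ⟩
      1#                                ∎
      where
      double : ∀ a h → a ℕ.* h ℕ.+ a ℕ.* h ≡ a ℕ.* (h ℕ.* 2)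
      double = solve-∀

    z≉1 : z ≉ 1#
    z≉1 z≈1 = ℕ.<⇒≱ ah<N (period-≥ (ℕ.>-nonZero⁻¹ _ {{ℕ.m*n≢0 a h {{a≢0}} {{>-nonZero 0<h}}}}) z≈1)
      where
      ah<N : a ℕ.* h < N
      ah<N = ℕ.*-monoʳ-< a (subst (h <_) (≡.sym q+1≡h*2) (ℕ.m<m*n h 2 {{>-nonZero 0<h}} (s≤s (s≤s z≤n))))

  [ωᴬ]^[1+q]≈1 : ∀ A → pow F (pow F ω A) (suc q) ≈ 1#
  [ωᴬ]^[1+q]≈1 A = begin
    pow F (pow F ω A) (suc q)            ≈⟨ pow-assocʳ ω A (suc q) ⟩
    pow F ω (A ℕ.* suc q)                ≈⟨ pow-assocʳ β a _ ⟩
    pow F β (a ℕ.* (A ℕ.* suc q))        ≡⟨ ≡.cong (pow F β) (exponent a A q) ⟩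
    pow F β (A ℕ.* N)                    ≈⟨ pow≈1⇒pow-*≈1 A pow-N≈1 ⟩
    1#                                   ∎
    where
    exponent : ∀ a A q → a ℕ.* (A ℕ.* suc q) ≡ A ℕ.* (a ℕ.* (q ℕ.+ 1))
    exponent = solve-∀

  ω-pow-injective : ∀ A B → pow F ω A ≈ pow F ω B → A ≡ B mod (q ℕ.+ 1)
  ω-pow-injective A B ωᴬ≈ωᴮ =
    *-cancelˡ-mod a (pow-injective _ _ (trans (sym (pow-assocʳ β a A)) (trans ωᴬ≈ωᴮ (pow-assocʳ β a B))))

  -- Compare the exponents of β ^ (K q) = - βᴷ / (ωᴬ ωᴮ) modulo N = a (q + 1).
  circle-difference : ∀ A B K → pow F ω A - pow F ω B ≈ pow F β K →
                      A ℕ.+ B ℕ.+ K ≡ h mod (q ℕ.+ 1)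
  circle-difference A B K X-Y≈βᴷ =
    *-cancelˡ-mod a (+-cancelˡ-mod K (subst₂ (_≡_mod N) exponent (ℕ.+-comm (a ℕ.* h) K)
      (pow-injective _ _ (begin
        pow F β (a ℕ.* A ℕ.+ a ℕ.* B ℕ.+ K ℕ.* q)
          ≈⟨ trans (pow-homo-* β (a ℕ.* A ℕ.+ a ℕ.* B) (K ℕ.* q))
                   (*-congʳ (pow-homo-* β (a ℕ.* A) (a ℕ.* B))) ⟩
        (pow F β (a ℕ.* A) * pow F β (a ℕ.* B)) * pow F β (K ℕ.* q)
          ≈⟨ *-cong (*-cong (pow-assocʳ β a A) (pow-assocʳ β a B)) (pow-assocʳ β K q) ⟨
        (X * Y) * pow F (pow F β K) q     ≈⟨ *-congˡ (pow-congˡ q (sym X-Y≈βᴷ)) ⟩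
        (X * Y) * pow F (X - Y) q         ≈⟨ *-congˡ (frobenius X Y) ⟩
        (X * Y) * (pow F X q - pow F Y q) ≈⟨ inverse-difference ([ωᴬ]^[1+q]≈1 A) ([ωᴬ]^[1+q]≈1 B) ⟩
        Y - X                             ≈⟨ y-x≈-[x-y] X Y ⟩
        - (X - Y)                         ≈⟨ -‿cong X-Y≈βᴷ ⟩
        - pow F β K                       ≈⟨ -1*x≈-x _ ⟨
        - 1# * pow F β K                  ≈⟨ *-congʳ -1≈β^[ah] ⟩
        pow F β (a ℕ.* h) * pow F β K     ≈⟨ pow-homo-* β (a ℕ.* h) K ⟨
        pow F β (a ℕ.* h ℕ.+ K)           ∎))))
    where
    X Y : Carrier
    X = pow F ω A
    Y = pow F ω B

    exponent : a ℕ.* A ℕ.+ a ℕ.* B ℕ.+ K ℕ.* q ≡ K ℕ.+ a ℕ.* (A ℕ.+ B ℕ.+ K)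
    exponent = ≡.subst (λ n → a ℕ.* A ℕ.+ a ℕ.* B ℕ.+ K ℕ.* n ≡ K ℕ.+ a ℕ.* (A ℕ.+ B ℕ.+ K))
                       (≡.sym q≡1+a) (expand a A B K)
      where
      expand : ∀ a A B K → a ℕ.* A ℕ.+ a ℕ.* B ℕ.+ K ℕ.* suc a ≡ K ℕ.+ a ℕ.* (A ℕ.+ B ℕ.+ K)
      expand = solve-∀

  module Cosets (m : ℕ) .{{_ : NonZero m}} (m∣q+1 : m ∣ q ℕ.+ 1) where

    InQi⇒pow : ∀ i {x} → InQi F ω m i x → ∃ λ j → x ≈ pow F ω (i ℕ.+ j ℕ.* m)
    InQi⇒pow i {x} (j , x≈ωⁱ[ωᵐ]ʲ) = j , (begin
      x                                 ≈⟨ x≈ωⁱ[ωᵐ]ʲ ⟩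
      pow F ω i * pow F (pow F ω m) j   ≈⟨ *-congˡ (pow-assocʳ ω m j) ⟩
      pow F ω i * pow F ω (m ℕ.* j)     ≡⟨ ≡.cong (λ n → pow F ω i * pow F ω n) (ℕ.*-comm m j) ⟩
      pow F ω i * pow F ω (j ℕ.* m)     ≈⟨ pow-homo-* ω i (j ℕ.* m) ⟨
      pow F ω (i ℕ.+ j ℕ.* m)           ∎)

    pow⇒InQi : ∀ {x} j → x ≈ pow F ω j → InQi F ω m (j % m) x
    pow⇒InQi {x} j x≈ωʲ = j / m , (begin
      x                                       ≈⟨ x≈ωʲ ⟩
      pow F ω j                               ≡⟨ ≡.cong (pow F ω) (m≡m%n+[m/n]*n j m) ⟩
      pow F ω (j % m ℕ.+ j / m ℕ.* m)         ≈⟨ pow-homo-* ω (j % m) _ ⟩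
      pow F ω (j % m) * pow F ω (j / m ℕ.* m)
        ≡⟨ ≡.cong (λ n → pow F ω (j % m) * pow F ω n) (ℕ.*-comm (j / m) m) ⟩
      pow F ω (j % m) * pow F ω (m ℕ.* (j / m)) ≈⟨ *-congˡ (pow-assocʳ ω m (j / m)) ⟨
      pow F ω (j % m) * pow F (pow F ω m) (j / m) ∎)

    private
      ≡-mod-m : ∀ {x y} → x ≡ y mod (q ℕ.+ 1) → x ≡ y mod m
      ≡-mod-m = ≡-mod-∣ m∣q+1

      exponent-of-difference : ∀ i j u v K {x y} →
        x ≈ pow F ω (i ℕ.+ u ℕ.* m) → y ≈ pow F ω (j ℕ.+ v ℕ.* m) → x - y ≈ pow F β K →
        i ℕ.+ j ℕ.+ K ≡ h mod m
      exponent-of-difference i j u v K x≈ωᴬ y≈ωᴮ x-y≈βᴷ = mod-trans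
        (+-mod (+-mod (mod-sym (x+k*n≡x i u)) (mod-sym (x+k*n≡x j v))) (mod-refl K))
        (≡-mod-m (circle-difference (i ℕ.+ u ℕ.* m) (j ℕ.+ v ℕ.* m) K
          (trans (+-cong (sym x≈ωᴬ) (-‿cong (sym y≈ωᴮ))) x-y≈βᴷ)))

    adjacent⇒≡h : ∀ i j {x y} → InQi F ω m i x → InQi F ω m j y → Adj F m x y →
                  i ℕ.+ j ≡ h mod m
    adjacent⇒≡h i j {x} {y} xᵢ yⱼ (_ , z , z≉0 , zᵐ≈x-y)
      with InQi⇒pow i xᵢ | InQi⇒pow j yⱼ | proj₂ prim z z≉0
    ... | u , x≈ωᴬ | v , y≈ωᴮ | s , βˢ≈z = mod-trans (mod-sym (x+k*n≡x (i ℕ.+ j) s))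
      (exponent-of-difference i j u v (s ℕ.* m) x≈ωᴬ y≈ωᴮ (begin
        x - y               ≈⟨ zᵐ≈x-y ⟨
        pow F z m           ≈⟨ pow-congˡ m βˢ≈z ⟨
        pow F (pow F β s) m ≈⟨ pow-assocʳ β s m ⟩
        pow F β (s ℕ.* m)   ∎))

    ≡h⇒adjacent : ∀ i j {x y} → InQi F ω m i x → InQi F ω m j y → i ℕ.+ j ≡ h mod m → x ≉ y →
                  Adj F m x y
    ≡h⇒adjacent i j {x} {y} xᵢ yⱼ i+j≡h x≉y
      with InQi⇒pow i xᵢ | InQi⇒pow j yⱼ | proj₂ prim (x - y) (x≉y ∘ x-y≈0⇒x≈y)
    ... | u , x≈ωᴬ | v , y≈ωᴮ | K , βᴷ≈x-y = x≉y , power-of-β m∣K βᴷ≈x-y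
      where
      m∣K : m ∣ K
      m∣K = ≡0⇒∣ (x+k≡x⇒k≡0
        (mod-trans (exponent-of-difference i j u v K x≈ωᴬ y≈ωᴮ (sym βᴷ≈x-y)) (mod-sym i+j≡h)))

      power-of-β : ∀ {K z} → m ∣ K → pow F β K ≈ z → Σ Carrier λ w → w ≉ 0# × pow F w m ≈ z
      power-of-β {K} {z} (divides w K≡w*m) βᴷ≈z = pow F β w , pow-≉0 w (proj₁ prim) , (begin
        pow F (pow F β w) m  ≈⟨ pow-assocʳ β w m ⟩
        pow F β (w ℕ.* m)    ≡⟨ ≡.cong (pow F β) K≡w*m ⟨
        pow F β K            ≈⟨ βᴷ≈z ⟩
        z                    ∎)

    coset-≈⇒≡ : ∀ i j {x y} → InQi F ω m i x → InQi F ω m j y → x ≈ y → i ≡ j mod m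
    coset-≈⇒≡ i j xᵢ yⱼ x≈y with InQi⇒pow i xᵢ | InQi⇒pow j yⱼ
    ... | u , x≈ωᴬ | v , y≈ωᴮ = mod-trans (mod-sym (x+k*n≡x i u)) (mod-trans
      (≡-mod-m (ω-pow-injective _ _ (trans (sym x≈ωᴬ) (trans x≈y y≈ωᴮ)))) (x+k*n≡x j v))

    module Edges (t : ℕ) (h≡t : h ≡ t mod m) where

      all-edges : ∀ i j → i ℕ.+ j ≡ t mod m → ¬ i ≡ j mod m → AllEdges F ω m i j
      all-edges i j i+j≡t i≢j x y xᵢ yⱼ =
        ≡h⇒adjacent i j xᵢ yⱼ (mod-trans i+j≡t (mod-sym h≡t)) (i≢j ∘ coset-≈⇒≡ i j xᵢ yⱼ)

      no-edges : ∀ i j → ¬ i ℕ.+ j ≡ t mod m → NoEdges F ω m i j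
      no-edges i j i+j≢t x y xᵢ yⱼ x~y = i+j≢t (mod-trans (adjacent⇒≡h i j xᵢ yⱼ x~y) h≡t)

      clique : ∀ i → i ℕ.+ i ≡ t mod m → Clique F ω m i
      clique i i+i≡t x y xᵢ yᵢ = ≡h⇒adjacent i i xᵢ yᵢ (mod-trans i+i≡t (mod-sym h≡t))

      independent : ∀ i → ¬ i ℕ.+ i ≡ t mod m → Independent F ω m i
      independent i = no-edges i i

      complete-bipartite : ∀ i j → i < j → j < m →
        ¬ i ℕ.+ i ≡ t mod m → ¬ j ℕ.+ j ≡ t mod m → i ℕ.+ j ≡ t mod m → CompleteBipartite F ω m i j
      complete-bipartite i j i<j j<m i+i≢t j+j≢t i+j≡t =
        independent i i+i≢t , independent j j+j≢t ,
        all-edges i j i+j≡t (<⇒≢-mod i<j j<m)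

      complete-bipartite-pair : ∀ k T → k ℕ.+ k < T → T ∸ k < m → T ≡ t mod m →
        ¬ k ℕ.+ k ≡ t mod m → ¬ (T ∸ k) ℕ.+ (T ∸ k) ≡ t mod m → CompleteBipartite F ω m k (T ∸ k)
      complete-bipartite-pair k T k+k<T T∸k<m T≡t k+k≢t l+l≢t =
        complete-bipartite k (T ∸ k) (k+k<n⇒k<n∸k k k+k<T) T∸k<m k+k≢t l+l≢t
          (subst (_≡ t mod m) (≡.sym (ℕ.m+[n∸m]≡n (ℕ.≤-trans (ℕ.m≤m+n k k) (ℕ.<⇒≤ k+k<T)))) T≡t)

      edges-between : t < m → ∀ i j → i < j → j < m →
        ((i ℕ.+ j) % m ≡ t → AllEdges F ω m i j) × ((i ℕ.+ j) % m ≢ t → NoEdges F ω m i j)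
      edges-between t<m i j i<j j<m =
        (λ i+j%m≡t → all-edges i j (%≡⇒≡-mod (≡.trans i+j%m≡t (≡.sym (m<n⇒m%n≡m t<m))))
                       (<⇒≢-mod i<j j<m)) ,
        (λ i+j%m≢t → no-edges i j (λ i+j≡t → i+j%m≢t (≡.trans (≡-mod⇒%≡ i+j≡t) (m<n⇒m%n≡m t<m))))

module Theorem41 (F : Field) {p k : ℕ} (p-prime : Prime p) (0<k : 0 ℕ.< k)
                 (q : ℕ) (q≡pᵏ : q ≡ p ℕ.^ k) (q-odd : ¬ 2 ∣ q)
                 (card : HasCardinality F (q ℕ.* q))
                 (β : Field.Carrier F) (prim : Primitive F β)
                 (m : ℕ) .{{_ : NonZero m}} (m∣q+1 : m ∣ q ℕ.+ 1) where
  open import Data.Nat using (zero; _+_; _*_; _∸_; _≤_; _<_; z≤n; z<s; s≤s)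
  import Data.Nat.Properties as ℕ
  open import Data.Nat.DivMod using (_%_; _/_; m*n/n≡m; m%n<n)
  open import Data.Nat.Divisibility using (divides; ∣-refl; ∣m+n∣m⇒∣n)
  open import Data.Nat.Tactic.RingSolver using (solve-∀)
  open import Data.Product using (∃; _×_; _,_; proj₁; proj₂)
  open import Data.Sum using (_⊎_; inj₁; inj₂)
  open import Relation.Nullary using (contradiction)
  open import Relation.Binary.PropositionalEquality
  open NatCongruence
  open NatArithmetic
  open UnitCircle F p-prime 0<k q q≡pᵏ q-odd card β prim using (ω; h; q+1≡h*2; module Cosets)
  open Cosets m m∣q+1 using (pow⇒InQi; module Edges)

  0<m : 0 < m
  0<m = ℕ.>-nonZero⁻¹ m

  m≡0 : m ≡ 0 mod m
  m≡0 = ∣⇒≡0 ∣-refl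

  module Even (r : ℕ) (m≡r*2 : m ≡ r * 2) where

    m≡r+r : m ≡ r + r
    m≡r+r = trans m≡r*2 (n*2≡n+n r)

    m/2≡r : m / 2 ≡ r
    m/2≡r = trans (cong (_/ 2) m≡r*2) (m*n/n≡m r 2)

    0<r : 0 < r
    0<r = 0<m*n⇒0<m 2 (subst (0 <_) m≡r*2 0<m)

    m/2<m : m / 2 < m
    m/2<m = subst₂ _<_ (sym m/2≡r) (sym m≡r+r) (ℕ.m<m+n r 0<r)

    3m≡3r*2 : 3 * m ≡ 3 * r * 2
    3m≡3r*2 = trans (cong (3 *_) m≡r*2) (sym (ℕ.*-assoc 3 r 2))

    3m/2≡3r : (3 * m) / 2 ≡ 3 * r
    3m/2≡3r = trans (cong (_/ 2) 3m≡3r*2) (m*n/n≡m (3 * r) 2)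

    3m/2≡m/2+m : (3 * m) / 2 ≡ m / 2 + m
    3m/2≡m/2+m = trans 3m/2≡3r (trans (triple r) (sym (cong₂ _+_ m/2≡r m≡r*2)))
      where
      triple : ∀ r → 3 * r ≡ r + r * 2
      triple = solve-∀

    3m/2∸k<m : ∀ {k} → m / 2 < k → (3 * m) / 2 ∸ k < m
    3m/2∸k<m {k} m/2<k = ℕ.m<n+o⇒m∸n<o ((3 * m) / 2) k
      (subst (_< k + m) (sym 3m/2≡m/2+m) (ℕ.+-monoˡ-< m m/2<k))

  part₁ : m ∣ h → ∀ i₁ i₂ → i₁ < i₂ → i₂ < m →
    ((i₁ + i₂) % m ≡ 0 → AllEdges F ω m i₁ i₂) × ((i₁ + i₂) % m ≢ 0 → NoEdges F ω m i₁ i₂)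
  part₁ m∣h = edges-between 0<m
    where open Edges 0 (∣⇒≡0 m∣h)

  part₁₁ : m ∣ h → ¬ 2 ∣ m →
    Clique F ω m 0 × (∀ i → 1 ≤ i → i < m → Independent F ω m i) ×
    (∀ k → 1 ≤ k → k ≤ (m ∸ 1) / 2 → CompleteBipartite F ω m k (m ∸ k))
  part₁₁ m∣h 2∤m = clique 0 (mod-refl 0) , (λ i 0<i i<m → independent i (no-double i 0<i i<m)) , pairs
    where
    open Edges 0 (∣⇒≡0 m∣h)

    no-double : ∀ i → 0 < i → i < m → ¬ i + i ≡ 0 mod m
    no-double i 0<i i<m i+i≡0 = 2∤m (subst (2 ∣_) (double≡0 0<i i<m i+i≡0) (2∣n+n i))

    pairs : ∀ k → 1 ≤ k → k ≤ (m ∸ 1) / 2 → CompleteBipartite F ω m k (m ∸ k)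
    pairs k 0<k k≤ = complete-bipartite-pair k m k+k<m m∸k<m m≡0
      (no-double k 0<k k<m) (no-double (m ∸ k) (ℕ.m<n⇒0<n∸m k<m) m∸k<m)
      where
      k+k<m : k + k < m
      k+k<m = half-bound 0<m k≤

      k<m : k < m
      k<m = ℕ.≤-<-trans (ℕ.m≤m+n k k) k+k<m

      m∸k<m : m ∸ k < m
      m∸k<m = ℕ.∸-monoʳ-< 0<k (ℕ.<⇒≤ k<m)

  part₁₂ : m ∣ h → 2 ∣ m →
    Clique F ω m 0 × Clique F ω m (m / 2) ×
    (∀ i → 1 ≤ i → i < m → i ≢ m / 2 → Independent F ω m i) ×
    (4 ≤ m → ∀ k → 1 ≤ k → k ≤ m / 2 ∸ 1 → CompleteBipartite F ω m k (m ∸ k))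
  part₁₂ m∣h (divides r m≡r*2) =
    clique 0 (mod-refl 0) ,
    clique (m / 2) (subst (λ n → n + n ≡ 0 mod m) (sym m/2≡r) (subst (_≡ 0 mod m) m≡r+r m≡0)) ,
    (λ i 0<i i<m i≢m/2 → independent i (no-double i 0<i i<m (λ i≡r → i≢m/2 (trans i≡r (sym m/2≡r))))) ,
    (λ _ → pairs)
    where
    open Even r m≡r*2
    open Edges 0 (∣⇒≡0 m∣h)

    no-double : ∀ i → 0 < i → i < m → i ≢ r → ¬ i + i ≡ 0 mod m
    no-double i 0<i i<m i≢r i+i≡0 = i≢r (n+n≡m+m⇒n≡m (trans (double≡0 0<i i<m i+i≡0) m≡r+r))

    pairs : ∀ k → 1 ≤ k → k ≤ m / 2 ∸ 1 → CompleteBipartite F ω m k (m ∸ k)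
    pairs k 0<k k≤ = complete-bipartite-pair k m k+k<m m∸k<m m≡0
      (no-double k 0<k (ℕ.<-trans k<r (ℕ.≤-<-trans (ℕ.<⇒≤ r<m∸k) m∸k<m)) (ℕ.<⇒≢ k<r))
      (no-double (m ∸ k) (ℕ.m<n⇒0<n∸m k<m) m∸k<m (ℕ.>⇒≢ r<m∸k))
      where
      k<r : k < r
      k<r = ≤∸1⇒< 0<r (subst (λ n → k ≤ n ∸ 1) m/2≡r k≤)

      k+k<m : k + k < m
      k+k<m = subst (k + k <_) (sym m≡r+r) (ℕ.+-mono-< k<r k<r)

      k<m : k < m
      k<m = ℕ.≤-<-trans (ℕ.m≤m+n k k) k+k<m

      m∸k<m : m ∸ k < m
      m∸k<m = ℕ.∸-monoʳ-< 0<k (ℕ.<⇒≤ k<m)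

      r<m∸k : r < m ∸ k
      r<m∸k = ℕ.m+n≤o⇒m≤o∸n (suc r) (subst (r + k <_) (sym m≡r+r) (ℕ.+-monoʳ-< r k<r))

  module HalfResidue (m∤h : ¬ m ∣ h) where
    private
      residue : ∃ λ r → (m ≡ r * 2) × (h ≡ r mod m)
      residue = ¬∣half⇒half-residue {c = _∣_.quotient m∣q+1} (trans (sym q+1≡h*2) (_∣_.equality m∣q+1)) m∤h

    r : ℕ
    r = proj₁ residue

    m≡r*2 : m ≡ r * 2
    m≡r*2 = proj₁ (proj₂ residue)

    open Even r m≡r*2 public
    open Edges (m / 2) (subst (λ n → h ≡ n mod m) (sym m/2≡r) (proj₂ (proj₂ residue))) public

  part₂ : ¬ m ∣ h → 2 ∣ m × (∀ i₁ i₂ → i₁ < i₂ → i₂ < m →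
    ((i₁ + i₂) % m ≡ m / 2 → AllEdges F ω m i₁ i₂) × ((i₁ + i₂) % m ≢ m / 2 → NoEdges F ω m i₁ i₂))
  part₂ m∤h = divides r m≡r*2 , edges-between m/2<m
    where open HalfResidue m∤h

  part₂₁ : ¬ m ∣ h → ¬ 2 ∣ m / 2 →
    (∀ i → i < m → Independent F ω m i) ×
    (m ≡ 2 → (∀ x → InQ F ω x → InQi F ω m 0 x ⊎ InQi F ω m 1 x) × CompleteBipartite F ω m 0 1) ×
    (6 ≤ m →
      (∀ k → k ≤ (m ∸ 2) / 4 → CompleteBipartite F ω m k (m / 2 ∸ k)) ×
      (∀ k → m / 2 + 1 ≤ k → k ≤ (3 * m ∸ 2) / 4 → CompleteBipartite F ω m k ((3 * m) / 2 ∸ k)))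
  part₂₁ m∤h 2∤m/2 = (λ i i<m → independent i (no-double i i<m)) , two , (λ _ → low , high)
    where
    open HalfResidue m∤h

    no-double : ∀ i → i < m → ¬ i + i ≡ m / 2 mod m
    no-double i i<m i+i≡m/2 with double-residue i<m m/2<m i+i≡m/2
    ... | inj₁ i+i≡m/2′  = 2∤m/2 (subst (2 ∣_) i+i≡m/2′ (2∣n+n i))
    ... | inj₂ i+i≡m/2+m = 2∤m/2 (∣m+n∣m⇒∣n
            (subst (2 ∣_) (trans i+i≡m/2+m (ℕ.+-comm (m / 2) m)) (2∣n+n i)) (divides r m≡r*2))

    two : m ≡ 2 → (∀ x → InQ F ω x → InQi F ω m 0 x ⊎ InQi F ω m 1 x) × CompleteBipartite F ω m 0 1
    two m≡2 = cover , complete-bipartite 0 1 z<s 1<m (no-double 0 0<m) (no-double 1 1<m)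
                        (subst (λ n → 1 ≡ n mod m) (sym (cong (_/ 2) m≡2)) (mod-refl 1))
      where
      1<m : 1 < m
      1<m = subst (1 <_) (sym m≡2) ℕ.≤-refl

      cover : ∀ x → InQ F ω x → InQi F ω m 0 x ⊎ InQi F ω m 1 x
      cover x (j , x≈ωʲ) with j % m | pow⇒InQi j x≈ωʲ | m%n<n j m
      ... | zero        | x∈Q₀ | _     = inj₁ x∈Q₀
      ... | suc zero    | x∈Q₁ | _     = inj₂ x∈Q₁
      ... | suc (suc _) | _    | 2+<m = contradiction (subst (_ <_) m≡2 2+<m) λ { (s≤s (s≤s ())) }

    low : ∀ k → k ≤ (m ∸ 2) / 4 → CompleteBipartite F ω m k (m / 2 ∸ k)
    low k k≤ = complete-bipartite-pair k (m / 2) k+k<m/2 m/2∸k<m (mod-refl _)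
      (no-double k (ℕ.<-trans (k+k<n⇒k<n∸k k k+k<m/2) m/2∸k<m)) (no-double (m / 2 ∸ k) m/2∸k<m)
      where
      k+k<m/2 : k + k < m / 2
      k+k<m/2 = subst (k + k <_) (sym m/2≡r)
        (quarter-bound 0<r (subst (λ n → k ≤ (n ∸ 2) / 4) m≡r*2 k≤))

      m/2∸k<m : m / 2 ∸ k < m
      m/2∸k<m = ℕ.≤-<-trans (ℕ.m∸n≤m (m / 2) k) m/2<m

    high : ∀ k → m / 2 + 1 ≤ k → k ≤ (3 * m ∸ 2) / 4 → CompleteBipartite F ω m k ((3 * m) / 2 ∸ k)
    high k m/2<k k≤ = complete-bipartite-pair k ((3 * m) / 2) k+k<3m/2 3m/2∸k<m′
      (subst (_≡ m / 2 mod m) (sym 3m/2≡m/2+m) (x+n≡x _))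
      (no-double k (ℕ.<-trans (k+k<n⇒k<n∸k k k+k<3m/2) 3m/2∸k<m′)) (no-double ((3 * m) / 2 ∸ k) 3m/2∸k<m′)
      where
      3m/2∸k<m′ : (3 * m) / 2 ∸ k < m
      3m/2∸k<m′ = 3m/2∸k<m (subst (_≤ k) (ℕ.+-comm (m / 2) 1) m/2<k)

      k+k<3m/2 : k + k < (3 * m) / 2
      k+k<3m/2 = subst (k + k <_) (sym 3m/2≡3r)
        (quarter-bound (ℕ.*-monoʳ-< 3 0<r) (subst (λ n → k ≤ (n ∸ 2) / 4) 3m≡3r*2 k≤))

  part₂₂ : ¬ m ∣ h → 2 ∣ m / 2 →
    Clique F ω m (m / 4) × Clique F ω m ((3 * m) / 4) ×
    (∀ i → i < m → i ≢ m / 4 → i ≢ (3 * m) / 4 → Independent F ω m i) ×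
    (m ≡ 4 → CompleteBipartite F ω m 0 2) ×
    (8 ≤ m →
      (∀ k → k ≤ (m ∸ 4) / 4 → CompleteBipartite F ω m k (m / 2 ∸ k)) ×
      (∀ k → m / 2 + 1 ≤ k → k ≤ (3 * m ∸ 4) / 4 → CompleteBipartite F ω m k ((3 * m) / 2 ∸ k)))
  part₂₂ m∤h (divides s m/2≡s*2) =
    clique (m / 4) (subst (_≡ m / 2 mod m) (sym m/4+m/4≡m/2) (mod-refl _)) ,
    clique ((3 * m) / 4) (subst (_≡ m / 2 mod m) (sym 3m/4+3m/4≡m/2+m) (x+n≡x _)) ,
    (λ i i<m i≢m/4 i≢3m/4 → independent i (no-double i i<m i≢m/4 i≢3m/4)) ,
    four , (λ _ → low , high)
    where
    open HalfResidue m∤h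

    m≡s*4 : m ≡ s * 4
    m≡s*4 = trans m≡r*2 (trans (cong (_* 2) (trans (sym m/2≡r) m/2≡s*2)) (ℕ.*-assoc s 2 2))

    0<s : 0 < s
    0<s = 0<m*n⇒0<m 4 (subst (0 <_) m≡s*4 0<m)

    m/4≡s : m / 4 ≡ s
    m/4≡s = trans (cong (_/ 4) m≡s*4) (m*n/n≡m s 4)

    3m≡3s*4 : 3 * m ≡ 3 * s * 4
    3m≡3s*4 = trans (cong (3 *_) m≡s*4) (sym (ℕ.*-assoc 3 s 4))

    3m/4≡3s : (3 * m) / 4 ≡ 3 * s
    3m/4≡3s = trans (cong (_/ 4) 3m≡3s*4) (m*n/n≡m (3 * s) 4)

    m/2≡s+s : m / 2 ≡ s + s
    m/2≡s+s = trans m/2≡s*2 (n*2≡n+n s)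

    m/4+m/4≡m/2 : m / 4 + m / 4 ≡ m / 2
    m/4+m/4≡m/2 = trans (cong₂ _+_ m/4≡s m/4≡s) (sym m/2≡s+s)

    3m/4+3m/4≡m/2+m : (3 * m) / 4 + (3 * m) / 4 ≡ m / 2 + m
    3m/4+3m/4≡m/2+m = trans (cong₂ _+_ 3m/4≡3s 3m/4≡3s)
                            (trans (six s) (sym (cong₂ _+_ m/2≡s*2 m≡s*4)))
      where
      six : ∀ s → 3 * s + 3 * s ≡ s * 2 + s * 4
      six = solve-∀

    2s<3s : s + s < 3 * s
    2s<3s = subst (s + s <_) (sym (triple s)) (ℕ.m<m+n (s + s) 0<s)
      where
      triple : ∀ s → 3 * s ≡ s + s + s
      triple = solve-∀

    s<3s : s < 3 * s
    s<3s = ℕ.≤-<-trans (ℕ.m≤m+n s s) 2s<3s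

    3m/2≡3s+3s : (3 * m) / 2 ≡ 3 * s + 3 * s
    3m/2≡3s+3s = trans 3m/2≡m/2+m (trans (sym 3m/4+3m/4≡m/2+m) (cong₂ _+_ 3m/4≡3s 3m/4≡3s))

    no-double : ∀ i → i < m → i ≢ m / 4 → i ≢ (3 * m) / 4 → ¬ i + i ≡ m / 2 mod m
    no-double i i<m i≢m/4 i≢3m/4 i+i≡m/2 with double-residue i<m m/2<m i+i≡m/2
    ... | inj₁ i+i≡m/2′  = i≢m/4 (n+n≡m+m⇒n≡m (trans i+i≡m/2′ (sym m/4+m/4≡m/2)))
    ... | inj₂ i+i≡m/2+m = i≢3m/4 (n+n≡m+m⇒n≡m (trans i+i≡m/2+m (sym 3m/4+3m/4≡m/2+m)))

    no-double-< : ∀ i → i < m → i < s → ¬ i + i ≡ m / 2 mod m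
    no-double-< i i<m i<s = no-double i i<m (ℕ.<⇒≢ (subst (i <_) (sym m/4≡s) i<s))
                                          (ℕ.<⇒≢ (subst (i <_) (sym 3m/4≡3s) (ℕ.<-trans i<s s<3s)))

    no-double-<> : ∀ i → i < m → s < i → i ≢ 3 * s → ¬ i + i ≡ m / 2 mod m
    no-double-<> i i<m s<i i≢3s = no-double i i<m (ℕ.>⇒≢ (subst (_< i) (sym m/4≡s) s<i))
                                                (λ i≡3m/4 → i≢3s (trans i≡3m/4 3m/4≡3s))

    four : m ≡ 4 → CompleteBipartite F ω m 0 2
    four m≡4 = complete-bipartite 0 2 z<s (subst (2 <_) (sym m≡4) (s≤s (s≤s (s≤s z≤n))))
      (no-double 0 0<m (λ 0≡m/4 → contradiction (trans 0≡m/4 (cong (_/ 4) m≡4)) λ ())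
                     (λ 0≡3m/4 → contradiction (trans 0≡3m/4 (cong (λ n → (3 * n) / 4) m≡4)) λ ()))
      (no-double 2 (subst (2 <_) (sym m≡4) (s≤s (s≤s (s≤s z≤n))))
                 (λ 2≡m/4 → contradiction (trans 2≡m/4 (cong (_/ 4) m≡4)) λ ())
                 (λ 2≡3m/4 → contradiction (trans 2≡3m/4 (cong (λ n → (3 * n) / 4) m≡4)) λ ()))
      (subst (λ n → 2 ≡ n mod m) (sym (cong (_/ 2) m≡4)) (mod-refl 2))

    low : ∀ k → k ≤ (m ∸ 4) / 4 → CompleteBipartite F ω m k (m / 2 ∸ k)
    low k k≤ = complete-bipartite-pair k (m / 2) k+k<m/2 m/2∸k<m (mod-refl _)
      (no-double-< k (ℕ.<-trans (k+k<n⇒k<n∸k k k+k<m/2) m/2∸k<m) k<s)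
      (no-double-<> (m / 2 ∸ k) m/2∸k<m s<m/2∸k
        (ℕ.<⇒≢ (ℕ.≤-<-trans (subst (m / 2 ∸ k ≤_) m/2≡s+s (ℕ.m∸n≤m (m / 2) k)) 2s<3s)))
      where
      k<s : k < s
      k<s = quarter-bound′ 0<s (subst (λ n → k ≤ (n ∸ 4) / 4) m≡s*4 k≤)

      k+k<m/2 : k + k < m / 2
      k+k<m/2 = subst (k + k <_) (sym m/2≡s+s) (ℕ.+-mono-< k<s k<s)

      m/2∸k<m : m / 2 ∸ k < m
      m/2∸k<m = ℕ.≤-<-trans (ℕ.m∸n≤m (m / 2) k) m/2<m

      s<m/2∸k : s < m / 2 ∸ k
      s<m/2∸k = ℕ.m+n≤o⇒m≤o∸n (suc s) (subst (s + k <_) (sym m/2≡s+s) (ℕ.+-monoʳ-< s k<s))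

    high : ∀ k → m / 2 + 1 ≤ k → k ≤ (3 * m ∸ 4) / 4 → CompleteBipartite F ω m k ((3 * m) / 2 ∸ k)
    high k m/2<k k≤ = complete-bipartite-pair k ((3 * m) / 2) k+k<3m/2 3m/2∸k<m′
      (subst (_≡ m / 2 mod m) (sym 3m/2≡m/2+m) (x+n≡x _))
      (no-double-<> k (ℕ.<-trans (k+k<n⇒k<n∸k k k+k<3m/2) 3m/2∸k<m′) s<k (ℕ.<⇒≢ k<3s))
      (no-double-<> ((3 * m) / 2 ∸ k) 3m/2∸k<m′ (ℕ.<-trans s<3s 3s<3m/2∸k) (ℕ.>⇒≢ 3s<3m/2∸k))
      where
      m/2<k′ : m / 2 < k
      m/2<k′ = subst (_≤ k) (ℕ.+-comm (m / 2) 1) m/2<k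

      3m/2∸k<m′ : (3 * m) / 2 ∸ k < m
      3m/2∸k<m′ = 3m/2∸k<m m/2<k′

      k<3s : k < 3 * s
      k<3s = quarter-bound′ (ℕ.<-trans 0<s s<3s) (subst (λ n → k ≤ (n ∸ 4) / 4) 3m≡3s*4 k≤)

      k+k<3m/2 : k + k < (3 * m) / 2
      k+k<3m/2 = subst (k + k <_) (sym 3m/2≡3s+3s) (ℕ.+-mono-< k<3s k<3s)

      s<k : s < k
      s<k = ℕ.<-trans (subst (s <_) (sym m/2≡s+s) (ℕ.m<m+n s 0<s)) m/2<k′

      3s<3m/2∸k : 3 * s < (3 * m) / 2 ∸ k
      3s<3m/2∸k = ℕ.m+n≤o⇒m≤o∸n (suc (3 * s))
        (subst (3 * s + k <_) (sym 3m/2≡3s+3s) (ℕ.+-monoʳ-< (3 * s) k<3s))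

open import Data.Nat using (_+_; _*_; _∸_; _≤_; _<_)
open import Data.Nat.DivMod using (_/_; _%_)
open import Data.Product using (_×_; _,_)
open import Data.Sum using (_⊎_)
open import Relation.Binary.PropositionalEquality using (_≢_)

-- The argument works for every m ≥ 1.
theorem4p1 : (F : Field) (q m : ℕ) .{{_ : NonZero m}} (β : Field.Carrier F) →
  IsPrimePower q → ¬ (2 ∣ q) → HasCardinality F (q * q) →
  2 ≤ m → m ∣ q + 1 → Primitive F β →
  let ω = pow F β (q ∸ 1) in
  (m ∣ (q + 1) / 2 →
    (∀ i₁ i₂ → i₁ < i₂ → i₂ < m →
      ((i₁ + i₂) % m ≡ 0 → AllEdges F ω m i₁ i₂) ×
      ((i₁ + i₂) % m ≢ 0 → NoEdges F ω m i₁ i₂)))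
  × (m ∣ (q + 1) / 2 → ¬ (2 ∣ m) →
    Clique F ω m 0 ×
    (∀ i → 1 ≤ i → i < m → Independent F ω m i) ×
    (∀ k → 1 ≤ k → k ≤ (m ∸ 1) / 2 → CompleteBipartite F ω m k (m ∸ k)))
  × (m ∣ (q + 1) / 2 → 2 ∣ m →
    Clique F ω m 0 × Clique F ω m (m / 2) ×
    (∀ i → 1 ≤ i → i < m → i ≢ m / 2 → Independent F ω m i) ×
    (4 ≤ m → ∀ k → 1 ≤ k → k ≤ m / 2 ∸ 1 → CompleteBipartite F ω m k (m ∸ k)))
  × (¬ (m ∣ (q + 1) / 2) →
    2 ∣ m ×
    (∀ i₁ i₂ → i₁ < i₂ → i₂ < m →
      ((i₁ + i₂) % m ≡ m / 2 → AllEdges F ω m i₁ i₂) ×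
      ((i₁ + i₂) % m ≢ m / 2 → NoEdges F ω m i₁ i₂)))
  × (¬ (m ∣ (q + 1) / 2) → ¬ (2 ∣ m / 2) →
    (∀ i → i < m → Independent F ω m i) ×
    (m ≡ 2 → (∀ x → InQ F ω x → InQi F ω m 0 x ⊎ InQi F ω m 1 x) ×
             CompleteBipartite F ω m 0 1) ×
    (6 ≤ m →
      (∀ k → k ≤ (m ∸ 2) / 4 → CompleteBipartite F ω m k (m / 2 ∸ k)) ×
      (∀ k → m / 2 + 1 ≤ k → k ≤ (3 * m ∸ 2) / 4 →
        CompleteBipartite F ω m k ((3 * m) / 2 ∸ k))))
  × (¬ (m ∣ (q + 1) / 2) → 2 ∣ m / 2 →
    Clique F ω m (m / 4) × Clique F ω m ((3 * m) / 4) ×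
    (∀ i → i < m → i ≢ m / 4 → i ≢ (3 * m) / 4 → Independent F ω m i) ×
    (m ≡ 4 → CompleteBipartite F ω m 0 2) ×
    (8 ≤ m →
      (∀ k → k ≤ (m ∸ 4) / 4 → CompleteBipartite F ω m k (m / 2 ∸ k)) ×
      (∀ k → m / 2 + 1 ≤ k → k ≤ (3 * m ∸ 4) / 4 →
        CompleteBipartite F ω m k ((3 * m) / 2 ∸ k))))
theorem4p1 F q m β (p , k , p-prime , 0<k , q≡pᵏ) q-odd card _ m∣q+1 prim =
  part₁ , part₁₁ , part₁₂ , part₂ , part₂₁ , part₂₂
  where open Theorem41 F p-prime 0<k q q≡pᵏ q-odd card β prim m m∣q+1
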